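{- For nonnegative integers $s,t,r$ with $s>t$, \[ \sum_{D \in \mathcal{D}_{s,t}^{(r)}} q^{\mathrm{vmr}(D)} = q^{\binom{r+1}{2}}\begin{bmatrix} s+t\\ s+r\end{bmatrix}_q. \]
   Context: A ballot path from $(0,0)$ to $(s+t,s-t)$ is a sequence of lattice points $v_0=(0,0),v_1,\dots,v_{s+t}=(s+t,s-t)$ with each step $v_i-v_{i-1}\in\{(1,1),(1,-1)\}$, never going below the $x$-axis. A point $v_i$ ($0<i<s+t$) is a valley if $v_i-v_{i-1}=(1,-1)$ and $v_{i+1}-v_i=(1,1)$; a valley on the $x$-axis is a return. Each return may independently be marked or not; $\mathcal{D}_{s,t}^{(r)}$ is the set of ballot paths from $(0,0)$ to $(s+t,s-t)$ together with a choice of marked returns, with at least $r$ marked returns. For such $D$, $\mathrm{maj}(D)$ is the sum of the $x$-coordinates of all valleys of $D$, and $\mathrm{vmr}(D)=\mathrm{maj}(D)-\frac12\sum x_i$, the latter sum over the $x$-coordinates of the marked returns. $\begin{bmatrix} n\\ k\end{bmatrix}_q=\frac{(q;q)_n}{(q;q)_k(q;q)_{n-k}}$ for $n\ge k\ge0$ and $0$ otherwise, where $(q;q)_n=(1-q)\cdots(1-q^n)$. -}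

module Defs where

open import Data.Bool using (Bool; true; false; _∧_; if_then_else_; T)
open import Data.Nat as ℕ using (ℕ; zero; suc; _≤ᵇ_; _≡ᵇ_; pred; _<ᵇ_)
open import Data.Nat.Combinatorics using (_C_)
open import Data.Integer as ℤ using (ℤ; +_; -[1+_]; 0ℤ; 1ℤ)
open import Data.List using (List; []; _∷_; take; drop; length; map; concatMap; filterᵇ; foldr; upTo; replicate; _++_)
open import Data.Nat.ListAction using (sum)
open import Data.Product using (Σ; _×_; _,_; proj₁; proj₂)
open import Relation.Binary.PropositionalEquality using (_≡_)

-- Polynomials in q with integer coefficients, as coefficient lists
-- (lowest degree first).  Equality is coefficientwise.

Poly : Set
Poly = List ℤ

coeff : Poly → ℕ → ℤ
coeff []       _       = 0ℤ
coeff (a ∷ p)  zero    = a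
coeff (a ∷ p)  (suc k) = coeff p k

_≈ₚ_ : Poly → Poly → Set
p ≈ₚ p' = ∀ k → coeff p k ≡ coeff p' k

infix 4 _≈ₚ_
infixl 6 _⊕_
infixl 7 _⊗_

_⊕_ : Poly → Poly → Poly
[]      ⊕ p'       = p'
(a ∷ p) ⊕ []       = a ∷ p
(a ∷ p) ⊕ (b ∷ p') = (a ℤ.+ b) ∷ (p ⊕ p')

scale : ℤ → Poly → Poly
scale c = map (c ℤ.*_)

_⊗_ : Poly → Poly → Poly
[]      ⊗ p' = []
(a ∷ p) ⊗ p' = scale a p' ⊕ (0ℤ ∷ (p ⊗ p'))

qpow : ℕ → Poly
qpow k = replicate k 0ℤ ++ (1ℤ ∷ [])

qPoch : ℕ → Poly
qPoch zero    = 1ℤ ∷ []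
qPoch (suc n) = qPoch n ⊗ ((1ℤ ∷ []) ⊕ scale (ℤ.- 1ℤ) (qpow (suc n)))

-- Q is the Gaussian binomial [n k]_q = (q;q)_n / ((q;q)_k (q;q)_{n-k})
-- for n ≥ k (stated with the denominator cleared, in the integral
-- domain ℤ[q]), and Q = 0 otherwise.
IsQBinom : ℕ → ℕ → Poly → Set
IsQBinom n k Q with k ≤ᵇ n
... | true  = qPoch k ⊗ qPoch (n ℕ.∸ k) ⊗ Q ≈ₚ qPoch n
... | false = Q ≈ₚ []

-- Paths.  A path of length n is a list of n steps; true = (1,1) (up),
-- false = (1,-1) (down).  Step j (0-based) is v_{j+1} - v_j, so the
-- point v_i has x-coordinate i.

Path : Set
Path = List Bool

endHeight : Path → ℤ
endHeight []          = 0ℤ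
endHeight (true  ∷ p) = 1ℤ ℤ.+ endHeight p
endHeight (false ∷ p) = ℤ.- 1ℤ ℤ.+ endHeight p

height : Path → ℕ → ℤ
height p i = endHeight (take i p)

at : List Bool → ℕ → Bool
at []      _       = false
at (b ∷ l) zero    = b
at (b ∷ l) (suc i) = at l i

isDown : Path → ℕ → Bool
isDown []          _       = false
isDown (b ∷ p)     zero    = if b then false else true
isDown (b ∷ p)     (suc j) = isDown p j

isUp : Path → ℕ → Bool
isUp p j = at p j

-- v_i is a valley: 0 < i < n, v_i - v_{i-1} = (1,-1), v_{i+1} - v_i = (1,1)
valleyᵇ : Path → ℕ → Bool
valleyᵇ p i = (1 ≤ᵇ i) ∧ (isDown p (pred i) ∧ isUp p i)

returnᵇ : Path → ℕ → Bool
returnᵇ p i = valleyᵇ p i ∧ isZero (height p i)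
  where
  isZero : ℤ → Bool
  isZero (+ zero)  = true
  isZero (+ suc _) = false
  isZero -[1+ _ ]  = false

nonnegᵇ : ℤ → Bool
nonnegᵇ (+ _)    = true
nonnegᵇ -[1+ _ ] = false

ℤ≡ᵇ : ℤ → ℤ → Bool
ℤ≡ᵇ (+ m)     (+ n)     = m ≡ᵇ n
ℤ≡ᵇ -[1+ m ]  -[1+ n ]  = m ≡ᵇ n
ℤ≡ᵇ _         _         = false

allᵇ : (ℕ → Bool) → List ℕ → Bool
allᵇ f []       = true
allᵇ f (x ∷ xs) = f x ∧ allᵇ f xs

allLists : ℕ → List (List Bool)
allLists zero    = [] ∷ []
allLists (suc n) = concatMap (λ l → (true ∷ l) ∷ (false ∷ l) ∷ []) (allLists n)

ballotᵇ : ℕ → ℕ → Path → Bool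
ballotᵇ s t p =
  ((length p) ≡ᵇ (s ℕ.+ t)) ∧
  (ℤ≡ᵇ (endHeight p) ((+ s) ℤ.- (+ t)) ∧
   allᵇ (λ i → nonnegᵇ (height p i)) (upTo (suc (s ℕ.+ t))))

-- Marked paths.  A marking of a path of length n is a list m of n+1
-- booleans, m_i = true meaning v_i is marked; only returns may be marked.

MarkedPath : Set
MarkedPath = Path × List Bool

countTrue : List Bool → ℕ
countTrue []          = 0
countTrue (true  ∷ l) = suc (countTrue l)
countTrue (false ∷ l) = countTrue l

validMarkingᵇ : ℕ → Path → List Bool → Bool
validMarkingᵇ r p m =
  allᵇ (λ i → if at m i then returnᵇ p i else true) (upTo (length m)) ∧ (r ≤ᵇ countTrue m)

-- the finite set D^{(r)}_{s,t}, as a duplicate-free list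
𝒟 : ℕ → ℕ → ℕ → List MarkedPath
𝒟 s t r =
  concatMap
    (λ p → map (λ m → p , m) (filterᵇ (validMarkingᵇ r p) (allLists (suc (s ℕ.+ t)))))
    (filterᵇ (ballotᵇ s t) (allLists (s ℕ.+ t)))

maj : Path → ℕ
maj p = sum (map (λ i → if valleyᵇ p i then i else 0) (upTo (suc (length p))))

markedSum : List Bool → ℕ
markedSum m = sum (map (λ i → if at m i then i else 0) (upTo (length m)))

-- vmr(D) = maj(D) - (1/2) Σ x_i.  Returns have even x-coordinate and
-- maj(D) ≥ Σ x_i, so this is a natural number; the division and
-- truncated subtraction below are exact on marked paths.
vmr : MarkedPath → ℕ
vmr (p , m) = maj p ℕ.∸ (markedSum m ℕ./ 2)

genFun : ℕ → ℕ → ℕ → Poly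
genFun s t r = foldr (λ D acc → qpow (vmr D) ⊕ acc) [] (𝒟 s t r)

-- Let F(s,t,r) be the left-hand side, U(s,t,r) its part over paths not
-- ending with a down step and D(s,t,r) the rest.  Removing the last step:
--   D(s,t+1,r) = [t < s] F(s,t,r),
--   U(s+1,t,r) = U(s,t,r) + q^(s+t) D(s,t,r) + [s = t] q^t D(s,t,r-1),
-- since an up step after a down step creates a valley at x = s+t, a
-- return iff s = t, and marking it adds (s+t) - (s+t)/2 = t to vmr.
-- For t < s the closed forms F = q^C(r+1,2) [s+t, s+r] and
-- U = q^(C(r+1,2)+t-r) [s+t-1, s+r-1] obey the same recurrences (two
-- q-Pascal rules and symmetry), so a simultaneous induction proves both.
module Submission where

open import Defs
open import Data.Nat using (ℕ; _+_; _<_)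
open import Data.Nat.Combinatorics using (_C_)
open import Data.Product using (Σ; _×_)

open import Data.Product using (_,_)
open import Data.Sum using (inj₁; inj₂; _⊎_)
open import Data.Unit using (tt)
open import Data.Empty using (⊥; ⊥-elim)
open import Data.Bool as B using (Bool; true; false; _∧_; if_then_else_; not)
import Data.Bool.Properties as BP
open import Data.Nat as ℕ using (zero; suc; _≤_; _≤ᵇ_; _≡ᵇ_; _<ᵇ_; _∸_; z≤n; s≤s; pred)
import Data.Nat.Properties as NP
import Data.Nat.Combinatorics as NC
open import Data.Nat.DivMod using (_/_)
import Data.Nat.DivMod as DM
import Data.Nat.Divisibility as DV
open import Data.Nat.Solver renaming (module +-*-Solver to NS)
open import Data.Integer as ℤ using (ℤ; +_; -[1+_]; 0ℤ; 1ℤ) renaming (_+_ to _+ℤ_)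
import Data.Integer.Properties as ZP
open import Data.Integer.Solver renaming (module +-*-Solver to ZS)
open import Data.List using (List; []; _∷_; _∷ʳ_; _++_; length; map; concatMap; filterᵇ; foldr; upTo; take)
import Data.List.Properties as LP
open import Data.Nat.ListAction using (sum)
import Data.Nat.ListAction.Properties as SP
open import Relation.Nullary using (yes; no)
open import Relation.Binary.PropositionalEquality
open import Relation.Binary.Bundles using (Setoid)
import Relation.Binary.Reasoning.Setoid
open import Algebra.Bundles using (CommutativeMonoid)
import Algebra.Solver.CommutativeMonoid

-- Formal power series in q, as coefficient sequences.  All
-- generating functions are compared coefficientwise; the record
-- wrapper lets Agda infer both sides of an equation.

Series : Set
Series = ℕ → ℤ

infix 4 _≐_
record _≐_ (f g : Series) : Set where
  constructor mk≐
  field app : ∀ k → f k ≡ g k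
open _≐_ public

infixl 6 _⊞_
_⊞_ : Series → Series → Series
(f ⊞ g) k = f k +ℤ g k

𝟘 : Series
𝟘 _ = 0ℤ

shift₁ : Series → Series
shift₁ f zero    = 0ℤ
shift₁ f (suc k) = f k

shift : ℕ → Series → Series
shift zero    f = f
shift (suc a) f = shift₁ (shift a f)

≐-refl : ∀ {f} → f ≐ f
≐-refl = mk≐ (λ k → refl)

≐-sym : ∀ {f g} → f ≐ g → g ≐ f
≐-sym e = mk≐ (λ k → sym (app e k))

≐-trans : ∀ {f g h} → f ≐ g → g ≐ h → f ≐ h
≐-trans e e' = mk≐ (λ k → trans (app e k) (app e' k))

≐-reflexive : ∀ {f g} → f ≡ g → f ≐ g
≐-reflexive refl = ≐-refl

Series-setoid : Setoid _ _
Series-setoid = record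
  { Carrier = Series ; _≈_ = _≐_
  ; isEquivalence = record { refl = ≐-refl ; sym = ≐-sym ; trans = ≐-trans } }

module SeriesReasoning = Relation.Binary.Reasoning.Setoid Series-setoid

⊞-cong : ∀ {f f' g g'} → f ≐ f' → g ≐ g' → f ⊞ g ≐ f' ⊞ g'
⊞-cong e e' = mk≐ (λ k → cong₂ _+ℤ_ (app e k) (app e' k))

⊞-congˡ : ∀ {f f'} g → f ≐ f' → f ⊞ g ≐ f' ⊞ g
⊞-congˡ g e = ⊞-cong e (≐-refl {g})

⊞-congʳ : ∀ f {g g'} → g ≐ g' → f ⊞ g ≐ f ⊞ g'
⊞-congʳ f e = ⊞-cong (≐-refl {f}) e

⊞-comm : ∀ f g → f ⊞ g ≐ g ⊞ f
⊞-comm f g = mk≐ (λ k → ZP.+-comm (f k) (g k))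

⊞-assoc : ∀ f g h → (f ⊞ g) ⊞ h ≐ f ⊞ (g ⊞ h)
⊞-assoc f g h = mk≐ (λ k → ZP.+-assoc (f k) (g k) (h k))

⊞-identityˡ : ∀ f → 𝟘 ⊞ f ≐ f
⊞-identityˡ f = mk≐ (λ k → ZP.+-identityˡ (f k))

⊞-identityʳ : ∀ f → f ⊞ 𝟘 ≐ f
⊞-identityʳ f = mk≐ (λ k → ZP.+-identityʳ (f k))

⊞-zero : ∀ {f g} → f ≐ 𝟘 → g ≐ 𝟘 → f ⊞ g ≐ 𝟘
⊞-zero e e' = ≐-trans (⊞-cong e e') (⊞-identityˡ 𝟘)

⊞-interchange : ∀ a b c d → (a ⊞ b) ⊞ (c ⊞ d) ≐ (a ⊞ c) ⊞ (b ⊞ d)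
⊞-interchange a b c d = mk≐ λ k →
  ZS.solve 4 (λ a b c d → (a ZS.:+ b) ZS.:+ (c ZS.:+ d) ZS.:= (a ZS.:+ c) ZS.:+ (b ZS.:+ d))
    refl (a k) (b k) (c k) (d k)

⊞-swapˡ : ∀ a b c → a ⊞ (b ⊞ c) ≐ b ⊞ (a ⊞ c)
⊞-swapˡ a b c = ≐-trans (≐-sym (⊞-assoc a b c)) (≐-trans (⊞-congˡ c (⊞-comm a b)) (⊞-assoc b a c))

shift₁-cong : ∀ {f g} → f ≐ g → shift₁ f ≐ shift₁ g
shift₁-cong e = mk≐ λ { zero → refl ; (suc k) → app e k }

shift-cong : ∀ a {f g} → f ≐ g → shift a f ≐ shift a g
shift-cong zero    e = e
shift-cong (suc a) e = shift₁-cong (shift-cong a e)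

shift-⊞ : ∀ a f g → shift a (f ⊞ g) ≐ shift a f ⊞ shift a g
shift-⊞ zero    f g = ≐-refl
shift-⊞ (suc a) f g = ≐-trans (shift₁-cong (shift-⊞ a f g))
                             (mk≐ λ { zero → refl ; (suc k) → refl })

shift-𝟘 : ∀ a → shift a 𝟘 ≐ 𝟘
shift-𝟘 zero    = ≐-refl
shift-𝟘 (suc a) = ≐-trans (shift₁-cong (shift-𝟘 a)) (mk≐ λ { zero → refl ; (suc k) → refl })

shift-zero : ∀ a {f} → f ≐ 𝟘 → shift a f ≐ 𝟘
shift-zero a e = ≐-trans (shift-cong a e) (shift-𝟘 a)

shift-+ : ∀ a b f → shift (a + b) f ≡ shift a (shift b f)
shift-+ zero    b f = refl
shift-+ (suc a) b f = cong shift₁ (shift-+ a b f)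

shift-≡ : ∀ {a b} f → a ≡ b → shift a f ≐ shift b f
shift-≡ f refl = ≐-refl

shift-merge : ∀ a b c d f → a + b ≡ c + d → shift a (shift b f) ≐ shift c (shift d f)
shift-merge a b c d f e =
  ≐-reflexive (trans (sym (shift-+ a b f)) (trans (cong (λ z → shift z f) e) (shift-+ c d f)))

shift-merge₃ : ∀ a b c d e f → a + (b + c) ≡ d + e → shift a (shift b (shift c f)) ≐ shift d (shift e f)
shift-merge₃ a b c d e f eq =
  ≐-trans (shift-cong a (≐-reflexive (sym (shift-+ b c f)))) (shift-merge a (b + c) d e f eq)

when : Bool → Series → Series
when b f = if b then f else 𝟘

when-cong : ∀ b {f g} → f ≐ g → when b f ≐ when b g
when-cong true  e = e
when-cong false e = ≐-refl

when-cong-under : ∀ b {f g} → (b ≡ true → f ≐ g) → when b f ≐ when b g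
when-cong-under true  e = e refl
when-cong-under false e = ≐-refl

when-false : ∀ {b} f → b ≡ false → when b f ≐ 𝟘
when-false f refl = ≐-refl

when-𝟘 : ∀ b → when b 𝟘 ≐ 𝟘
when-𝟘 true  = ≐-refl
when-𝟘 false = ≐-refl

when-true : ∀ {b} f → b ≡ true → when b f ≐ f
when-true f refl = ≐-refl

when-split : ∀ b c f → when b f ≐ when (b ∧ not c) f ⊞ when (b ∧ c) f
when-split false c     f = ≐-sym (⊞-identityˡ 𝟘)
when-split true  false f = ≐-sym (⊞-identityʳ f)
when-split true  true  f = ≐-sym (⊞-identityˡ f)

coeff-⊕ : ∀ p p' k → coeff (p ⊕ p') k ≡ coeff p k +ℤ coeff p' k
coeff-⊕ []      p'       k       = sym (ZP.+-identityˡ (coeff p' k))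
coeff-⊕ (a ∷ p) []       k       = sym (ZP.+-identityʳ (coeff (a ∷ p) k))
coeff-⊕ (a ∷ p) (b ∷ p') zero    = refl
coeff-⊕ (a ∷ p) (b ∷ p') (suc k) = coeff-⊕ p p' k

coeff-scale : ∀ c p k → coeff (scale c p) k ≡ c ℤ.* coeff p k
coeff-scale c []      k       = sym (ZP.*-zeroʳ c)
coeff-scale c (a ∷ p) zero    = refl
coeff-scale c (a ∷ p) (suc k) = coeff-scale c p k

coeff-0∷ : ∀ p → coeff (0ℤ ∷ p) ≐ shift₁ (coeff p)
coeff-0∷ p = mk≐ λ { zero → refl ; (suc k) → refl }

mono : ℕ → Series
mono a = coeff (qpow a)

shift-mono : ∀ e a → shift e (mono a) ≐ mono (e + a)
shift-mono zero    a = ≐-refl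
shift-mono (suc e) a = ≐-trans (shift₁-cong (shift-mono e a)) (≐-sym (coeff-0∷ (qpow (e + a))))

coeff-qpow-⊗ : ∀ a p → coeff (qpow a ⊗ p) ≐ shift a (coeff p)
coeff-qpow-⊗ zero p = mk≐ λ k → begin
    coeff (scale 1ℤ p ⊕ (0ℤ ∷ [])) k          ≡⟨ coeff-⊕ (scale 1ℤ p) _ k ⟩
    coeff (scale 1ℤ p) k +ℤ coeff (0ℤ ∷ []) k  ≡⟨ cong₂ _+ℤ_ (coeff-scale 1ℤ p k) (coeff-[0] k) ⟩
    1ℤ ℤ.* coeff p k +ℤ 0ℤ                     ≡⟨ ZP.+-identityʳ _ ⟩
    1ℤ ℤ.* coeff p k                           ≡⟨ ZP.*-identityˡ _ ⟩
    coeff p k                                  ∎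
  where
  open ≡-Reasoning
  coeff-[0] : ∀ k → coeff (0ℤ ∷ []) k ≡ 0ℤ
  coeff-[0] zero    = refl
  coeff-[0] (suc k) = refl
coeff-qpow-⊗ (suc a) p = mk≐ λ k → begin
    coeff (scale 0ℤ p ⊕ (0ℤ ∷ (qpow a ⊗ p))) k                ≡⟨ coeff-⊕ (scale 0ℤ p) _ k ⟩
    coeff (scale 0ℤ p) k +ℤ coeff (0ℤ ∷ (qpow a ⊗ p)) k        ≡⟨ cong₂ _+ℤ_ (coeff-scale 0ℤ p k) (app (coeff-0∷ (qpow a ⊗ p)) k) ⟩
    0ℤ ℤ.* coeff p k +ℤ shift₁ (coeff (qpow a ⊗ p)) k          ≡⟨ cong (_+ℤ shift₁ (coeff (qpow a ⊗ p)) k) (ZP.*-zeroˡ (coeff p k)) ⟩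
    0ℤ +ℤ shift₁ (coeff (qpow a ⊗ p)) k                        ≡⟨ ZP.+-identityˡ _ ⟩
    shift₁ (coeff (qpow a ⊗ p)) k                              ≡⟨ app (shift₁-cong (coeff-qpow-⊗ a p)) k ⟩
    shift₁ (shift a (coeff p)) k                               ∎
  where open ≡-Reasoning

∑ : {A : Set} → (A → Series) → List A → Series
∑ f []       = 𝟘
∑ f (x ∷ xs) = f x ⊞ ∑ f xs

∑-cong : ∀ {A : Set} {f g : A → Series} xs → (∀ x → f x ≐ g x) → ∑ f xs ≐ ∑ g xs
∑-cong []       e = ≐-refl
∑-cong (x ∷ xs) e = ⊞-cong (e x) (∑-cong xs e)

∑-++ : ∀ {A : Set} (f : A → Series) xs ys → ∑ f (xs ++ ys) ≐ ∑ f xs ⊞ ∑ f ys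
∑-++ f []       ys = ≐-sym (⊞-identityˡ _)
∑-++ f (x ∷ xs) ys = ≐-trans (⊞-congʳ (f x) (∑-++ f xs ys)) (≐-sym (⊞-assoc (f x) (∑ f xs) (∑ f ys)))

∑-concatMap : ∀ {A B : Set} (f : B → Series) (g : A → List B) xs →
  ∑ f (concatMap g xs) ≐ ∑ (λ x → ∑ f (g x)) xs
∑-concatMap f g []       = ≐-refl
∑-concatMap f g (x ∷ xs) = ≐-trans (∑-++ f (g x) (concatMap g xs)) (⊞-congʳ (∑ f (g x)) (∑-concatMap f g xs))

∑-map : ∀ {A B : Set} (f : B → Series) (g : A → B) xs → ∑ f (map g xs) ≐ ∑ (λ x → f (g x)) xs
∑-map f g []       = ≐-refl
∑-map f g (x ∷ xs) = ⊞-congʳ (f (g x)) (∑-map f g xs)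

∑-filter : ∀ {A : Set} (f : A → Series) (P : A → Bool) xs →
  ∑ f (filterᵇ P xs) ≐ ∑ (λ x → when (P x) (f x)) xs
∑-filter f P [] = ≐-refl
∑-filter f P (x ∷ xs) with P x
... | true  = ⊞-congʳ (f x) (∑-filter f P xs)
... | false = ≐-trans (∑-filter f P xs) (≐-sym (⊞-identityˡ _))

∑-⊞ : ∀ {A : Set} (f g : A → Series) xs → ∑ (λ x → f x ⊞ g x) xs ≐ ∑ f xs ⊞ ∑ g xs
∑-⊞ f g []       = ≐-sym (⊞-identityˡ 𝟘)
∑-⊞ f g (x ∷ xs) = ≐-trans (⊞-congʳ (f x ⊞ g x) (∑-⊞ f g xs)) (⊞-interchange (f x) (g x) (∑ f xs) (∑ g xs))

∑-shift : ∀ {A : Set} a (f : A → Series) xs → ∑ (λ x → shift a (f x)) xs ≐ shift a (∑ f xs)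
∑-shift a f []       = ≐-sym (shift-𝟘 a)
∑-shift a f (x ∷ xs) = ≐-trans (⊞-congʳ (shift a (f x)) (∑-shift a f xs)) (≐-sym (shift-⊞ a (f x) (∑ f xs)))

∑-𝟘 : ∀ {A : Set} (xs : List A) → ∑ (λ _ → 𝟘) xs ≐ 𝟘
∑-𝟘 []       = ≐-refl
∑-𝟘 (x ∷ xs) = ≐-trans (⊞-identityˡ (∑ (λ _ → 𝟘) xs)) (∑-𝟘 xs)

∑-when : ∀ {A : Set} b (f : A → Series) xs → ∑ (λ x → when b (f x)) xs ≐ when b (∑ f xs)
∑-when true  f xs = ≐-refl
∑-when false f xs = ∑-𝟘 xs

∑-allLists-cons : ∀ (f : List Bool → Series) n →
  ∑ f (allLists (suc n)) ≐ ∑ (λ l → f (true ∷ l) ⊞ f (false ∷ l)) (allLists n)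
∑-allLists-cons f n = ≐-trans (∑-concatMap f _ (allLists n))
  (∑-cong (allLists n) (λ l → ⊞-congʳ (f (true ∷ l)) (⊞-identityʳ (f (false ∷ l)))))

∑-allLists-snoc : ∀ (f : List Bool → Series) n →
  ∑ f (allLists (suc n)) ≐ ∑ (λ l → f (l ∷ʳ true) ⊞ f (l ∷ʳ false)) (allLists n)
∑-allLists-snoc f zero    = ≐-sym (⊞-assoc (f (true ∷ [])) (f (false ∷ [])) 𝟘)
∑-allLists-snoc f (suc n) = begin
    ∑ f (allLists (suc (suc n)))                                        ≈⟨ ∑-allLists-cons f (suc n) ⟩
    ∑ g (allLists (suc n))                                              ≈⟨ ∑-allLists-snoc g n ⟩
    ∑ (λ l → g (l ∷ʳ true) ⊞ g (l ∷ʳ false)) (allLists n)               ≈⟨ ∑-cong (allLists n) (λ l →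
        ⊞-interchange (f (true ∷ (l ∷ʳ true))) (f (false ∷ (l ∷ʳ true)))
                      (f (true ∷ (l ∷ʳ false))) (f (false ∷ (l ∷ʳ false)))) ⟩
    ∑ (λ l → h (true ∷ l) ⊞ h (false ∷ l)) (allLists n)                 ≈⟨ ∑-allLists-cons h n ⟨
    ∑ h (allLists (suc n))                                              ∎
  where
  open SeriesReasoning
  g h : List Bool → Series
  g l = f (true ∷ l) ⊞ f (false ∷ l)
  h l = f (l ∷ʳ true) ⊞ f (l ∷ʳ false)

∑-allLists-cong : ∀ n (f g : List Bool → Series) → (∀ l → length l ≡ n → f l ≐ g l) →
  ∑ f (allLists n) ≐ ∑ g (allLists n)
∑-allLists-cong zero    f g e = ⊞-cong (e [] refl) ≐-refl
∑-allLists-cong (suc n) f g e = ≐-trans (∑-allLists-cons f n) (≐-trans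
  (∑-allLists-cong n (λ l → f (true ∷ l) ⊞ f (false ∷ l)) (λ l → g (true ∷ l) ⊞ g (false ∷ l))
     (λ l el → ⊞-cong (e (true ∷ l) (cong suc el)) (e (false ∷ l) (cong suc el))))
  (≐-sym (∑-allLists-cons g n)))

infix 4 _≋_
record _≋_ (p q : Poly) : Set where
  constructor mk≋
  field get : ∀ k → coeff p k ≡ coeff q k
open _≋_ public

≋-refl : ∀ {p} → p ≋ p
≋-refl = mk≋ (λ k → refl)

≋-sym : ∀ {p q} → p ≋ q → q ≋ p
≋-sym e = mk≋ (λ k → sym (get e k))

≋-trans : ∀ {p q r} → p ≋ q → q ≋ r → p ≋ r
≋-trans e e' = mk≋ (λ k → trans (get e k) (get e' k))

≋-reflexive : ∀ {p q} → p ≡ q → p ≋ q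
≋-reflexive refl = ≋-refl

Poly-setoid : Setoid _ _
Poly-setoid = record
  { Carrier = Poly ; _≈_ = _≋_
  ; isEquivalence = record { refl = ≋-refl ; sym = ≋-sym ; trans = ≋-trans } }

module PolyReasoning = Relation.Binary.Reasoning.Setoid Poly-setoid

𝟙 : Poly
𝟙 = 1ℤ ∷ []

⊕-cong : ∀ {p p' q q'} → p ≋ p' → q ≋ q' → p ⊕ q ≋ p' ⊕ q'
⊕-cong {p} {p'} {q} {q'} e e' = mk≋ λ k →
  trans (coeff-⊕ p q k) (trans (cong₂ _+ℤ_ (get e k) (get e' k)) (sym (coeff-⊕ p' q' k)))

⊕-identityʳ : ∀ p → p ⊕ [] ≋ p
⊕-identityʳ p = mk≋ (λ k → trans (coeff-⊕ p [] k) (ZP.+-identityʳ _))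

∷-cong : ∀ a {p q} → p ≋ q → a ∷ p ≋ a ∷ q
∷-cong a e = mk≋ λ { zero → refl ; (suc k) → get e k }

0∷[]≋[] : 0ℤ ∷ [] ≋ []
0∷[]≋[] = mk≋ λ { zero → refl ; (suc k) → refl }

scale-cong : ∀ c {p q} → p ≋ q → scale c p ≋ scale c q
scale-cong c {p} {q} e = mk≋ λ k →
  trans (coeff-scale c p k) (trans (cong (c ℤ.*_) (get e k)) (sym (coeff-scale c q k)))

scale-zero : ∀ p → scale 0ℤ p ≋ []
scale-zero p = mk≋ λ k → trans (coeff-scale 0ℤ p k) (ZP.*-zeroˡ (coeff p k))

coeff-⊗-zero : ∀ a p q → coeff ((a ∷ p) ⊗ q) zero ≡ a ℤ.* coeff q zero
coeff-⊗-zero a p q = trans (coeff-⊕ (scale a q) (0ℤ ∷ (p ⊗ q)) zero)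
  (trans (ZP.+-identityʳ _) (coeff-scale a q zero))

coeff-⊗-suc : ∀ a p q k → coeff ((a ∷ p) ⊗ q) (suc k) ≡ a ℤ.* coeff q (suc k) +ℤ coeff (p ⊗ q) k
coeff-⊗-suc a p q k = trans (coeff-⊕ (scale a q) (0ℤ ∷ (p ⊗ q)) (suc k))
  (cong (_+ℤ coeff (p ⊗ q) k) (coeff-scale a q (suc k)))

⊗-zeroʳ : ∀ p → p ⊗ [] ≋ []
⊗-zeroʳ []      = ≋-refl
⊗-zeroʳ (a ∷ p) = ≋-trans (∷-cong 0ℤ (⊗-zeroʳ p)) 0∷[]≋[]

⊗-congʳ : ∀ p {q q'} → q ≋ q' → p ⊗ q ≋ p ⊗ q'
⊗-congʳ []      e = ≋-refl
⊗-congʳ (a ∷ p) e = ⊕-cong (scale-cong a e) (∷-cong 0ℤ (⊗-congʳ p e))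

⊗-0∷ʳ : ∀ p q → p ⊗ (0ℤ ∷ q) ≋ 0ℤ ∷ (p ⊗ q)
⊗-0∷ʳ []      q = ≋-sym 0∷[]≋[]
⊗-0∷ʳ (a ∷ p) q = mk≋ λ
  { zero    → trans (ZP.+-identityʳ _) (ZP.*-zeroʳ a)
  ; (suc k) → trans (coeff-⊕ (scale a q) (p ⊗ (0ℤ ∷ q)) k)
      (trans (cong (coeff (scale a q) k +ℤ_) (get (⊗-0∷ʳ p q) k))
             (sym (coeff-⊕ (scale a q) (0ℤ ∷ (p ⊗ q)) k))) }

⊗-0∷ˡ : ∀ p q → (0ℤ ∷ p) ⊗ q ≋ 0ℤ ∷ (p ⊗ q)
⊗-0∷ˡ p q = ⊕-cong (scale-zero q) (≋-refl {0ℤ ∷ (p ⊗ q)})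

⊗-constʳ : ∀ p b → p ⊗ (b ∷ []) ≋ scale b p
⊗-constʳ []      b = ≋-refl
⊗-constʳ (a ∷ p) b = mk≋ λ
  { zero    → trans (ZP.+-identityʳ _) (ZP.*-comm a b)
  ; (suc k) → get (⊗-constʳ p b) k }

⊗-distribˡ-⊕ : ∀ p q q' → p ⊗ (q ⊕ q') ≋ p ⊗ q ⊕ p ⊗ q'
⊗-distribˡ-⊕ []      q q' = ≋-refl
⊗-distribˡ-⊕ (a ∷ p) q q' = mk≋ λ
  { zero → begin
      coeff ((a ∷ p) ⊗ (q ⊕ q')) zero                 ≡⟨ coeff-⊗-zero a p (q ⊕ q') ⟩
      a ℤ.* coeff (q ⊕ q') zero                       ≡⟨ cong (a ℤ.*_) (coeff-⊕ q q' zero) ⟩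
      a ℤ.* (coeff q zero +ℤ coeff q' zero)            ≡⟨ ZP.*-distribˡ-+ a (coeff q zero) (coeff q' zero) ⟩
      a ℤ.* coeff q zero +ℤ a ℤ.* coeff q' zero        ≡⟨ cong₂ _+ℤ_ (coeff-⊗-zero a p q) (coeff-⊗-zero a p q') ⟨
      coeff (a∷p⊗ q) zero +ℤ coeff (a∷p⊗ q') zero      ≡⟨ coeff-⊕ (a∷p⊗ q) (a∷p⊗ q') zero ⟨
      coeff (a∷p⊗ q ⊕ a∷p⊗ q') zero                   ∎
  ; (suc k) → begin
      coeff ((a ∷ p) ⊗ (q ⊕ q')) (suc k)              ≡⟨ coeff-⊗-suc a p (q ⊕ q') k ⟩
      a ℤ.* coeff (q ⊕ q') (suc k) +ℤ coeff (p ⊗ (q ⊕ q')) k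
        ≡⟨ cong₂ _+ℤ_ (cong (a ℤ.*_) (coeff-⊕ q q' (suc k)))
                      (trans (get (⊗-distribˡ-⊕ p q q') k) (coeff-⊕ (p ⊗ q) (p ⊗ q') k)) ⟩
      a ℤ.* (coeff q (suc k) +ℤ coeff q' (suc k)) +ℤ (coeff (p ⊗ q) k +ℤ coeff (p ⊗ q') k)
        ≡⟨ regroup a (coeff q (suc k)) (coeff q' (suc k)) (coeff (p ⊗ q) k) (coeff (p ⊗ q') k) ⟩
      (a ℤ.* coeff q (suc k) +ℤ coeff (p ⊗ q) k) +ℤ (a ℤ.* coeff q' (suc k) +ℤ coeff (p ⊗ q') k)
        ≡⟨ cong₂ _+ℤ_ (coeff-⊗-suc a p q k) (coeff-⊗-suc a p q' k) ⟨
      coeff (a∷p⊗ q) (suc k) +ℤ coeff (a∷p⊗ q') (suc k) ≡⟨ coeff-⊕ (a∷p⊗ q) (a∷p⊗ q') (suc k) ⟨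
      coeff (a∷p⊗ q ⊕ a∷p⊗ q') (suc k)                ∎ }
  where
  open ≡-Reasoning
  a∷p⊗ : Poly → Poly
  a∷p⊗ r = (a ∷ p) ⊗ r
  regroup : ∀ a x y u v → a ℤ.* (x +ℤ y) +ℤ (u +ℤ v) ≡ (a ℤ.* x +ℤ u) +ℤ (a ℤ.* y +ℤ v)
  regroup = ZS.solve 5 (λ a x y u v →
    a ZS.:* (x ZS.:+ y) ZS.:+ (u ZS.:+ v) ZS.:= (a ZS.:* x ZS.:+ u) ZS.:+ (a ZS.:* y ZS.:+ v)) refl

scale-⊗ : ∀ a q r → scale a q ⊗ r ≋ scale a (q ⊗ r)
scale-⊗ a []      r = ≋-refl
scale-⊗ a (b ∷ q) r = mk≋ λ
  { zero → trans (coeff-⊗-zero (a ℤ.* b) (scale a q) r)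
      (trans (ZP.*-assoc a b _) (trans (cong (a ℤ.*_) (sym (coeff-⊗-zero b q r)))
             (sym (coeff-scale a ((b ∷ q) ⊗ r) zero))))
  ; (suc k) → trans (coeff-⊗-suc (a ℤ.* b) (scale a q) r k)
      (trans (cong₂ _+ℤ_ (ZP.*-assoc a b _) (trans (get (scale-⊗ a q r) k) (coeff-scale a (q ⊗ r) k)))
      (trans (sym (ZP.*-distribˡ-+ a (b ℤ.* coeff r (suc k)) (coeff (q ⊗ r) k)))
      (trans (cong (a ℤ.*_) (sym (coeff-⊗-suc b q r k))) (sym (coeff-scale a ((b ∷ q) ⊗ r) (suc k)))))) }

⊗-comm : ∀ p q → p ⊗ q ≋ q ⊗ p
⊗-comm []      q = ≋-sym (⊗-zeroʳ q)
⊗-comm (a ∷ p) q = begin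
    scale a q ⊕ (0ℤ ∷ (p ⊗ q))       ≈⟨ ⊕-cong (≋-sym (⊗-constʳ q a))
                                               (≋-trans (∷-cong 0ℤ (⊗-comm p q)) (≋-sym (⊗-0∷ʳ q p))) ⟩
    q ⊗ (a ∷ []) ⊕ q ⊗ (0ℤ ∷ p)      ≈⟨ ⊗-distribˡ-⊕ q (a ∷ []) (0ℤ ∷ p) ⟨
    q ⊗ ((a +ℤ 0ℤ) ∷ p)               ≈⟨ ⊗-congʳ q (mk≋ λ { zero → ZP.+-identityʳ a ; (suc k) → refl }) ⟩
    q ⊗ (a ∷ p)                       ∎
  where open PolyReasoning

⊗-congˡ : ∀ {p p'} q → p ≋ p' → p ⊗ q ≋ p' ⊗ q
⊗-congˡ {p} {p'} q e = ≋-trans (⊗-comm p q) (≋-trans (⊗-congʳ q e) (⊗-comm q p'))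

⊗-cong : ∀ {p p' q q'} → p ≋ p' → q ≋ q' → p ⊗ q ≋ p' ⊗ q'
⊗-cong {p} {p'} {q} e e' = ≋-trans (⊗-congˡ q e) (⊗-congʳ p' e')

⊗-distribʳ-⊕ : ∀ p p' q → (p ⊕ p') ⊗ q ≋ p ⊗ q ⊕ p' ⊗ q
⊗-distribʳ-⊕ p p' q =
  ≋-trans (⊗-comm (p ⊕ p') q) (≋-trans (⊗-distribˡ-⊕ q p p') (⊕-cong (⊗-comm q p) (⊗-comm q p')))

⊗-assoc : ∀ p q r → (p ⊗ q) ⊗ r ≋ p ⊗ (q ⊗ r)
⊗-assoc []      q r = ≋-refl
⊗-assoc (a ∷ p) q r = begin
    (scale a q ⊕ (0ℤ ∷ (p ⊗ q))) ⊗ r        ≈⟨ ⊗-distribʳ-⊕ (scale a q) (0ℤ ∷ (p ⊗ q)) r ⟩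
    scale a q ⊗ r ⊕ (0ℤ ∷ (p ⊗ q)) ⊗ r      ≈⟨ ⊕-cong (scale-⊗ a q r)
                                                 (≋-trans (⊗-0∷ˡ (p ⊗ q) r) (∷-cong 0ℤ (⊗-assoc p q r))) ⟩
    scale a (q ⊗ r) ⊕ (0ℤ ∷ (p ⊗ (q ⊗ r)))  ∎
  where open PolyReasoning

⊗-identityˡ : ∀ p → 𝟙 ⊗ p ≋ p
⊗-identityˡ p = mk≋ (app (coeff-qpow-⊗ 0 p))

⊗-identityʳ : ∀ p → p ⊗ 𝟙 ≋ p
⊗-identityʳ p = ≋-trans (⊗-comm p 𝟙) (⊗-identityˡ p)

qpow-+ : ∀ a b → qpow a ⊗ qpow b ≋ qpow (a + b)
qpow-+ a b = mk≋ λ k → trans (app (coeff-qpow-⊗ a (qpow b)) k) (app (shift-mono a b) k)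

⊗-commutativeMonoid : CommutativeMonoid _ _
⊗-commutativeMonoid = record
  { Carrier = Poly ; _≈_ = _≋_ ; _∙_ = _⊗_ ; ε = 𝟙
  ; isCommutativeMonoid = record
    { isMonoid = record
      { isSemigroup = record
        { isMagma = record { isEquivalence = Setoid.isEquivalence Poly-setoid ; ∙-cong = ⊗-cong }
        ; assoc = ⊗-assoc }
      ; identity = ⊗-identityˡ , ⊗-identityʳ }
    ; comm = ⊗-comm } }

module ⊗-Solver = Algebra.Solver.CommutativeMonoid ⊗-commutativeMonoid

gauss : ℕ → ℕ → Poly
gauss n       zero    = 𝟙
gauss zero    (suc k) = []
gauss (suc n) (suc k) = gauss n k ⊕ qpow (suc k) ⊗ gauss n (suc k)

gauss-vanish : ∀ n k → n < k → gauss n k ≋ []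
gauss-vanish zero    (suc k) _         = ≋-refl
gauss-vanish (suc n) (suc k) (s≤s n<k) =
  ⊕-cong (gauss-vanish n k n<k)
         (≋-trans (⊗-congʳ (qpow (suc k)) (gauss-vanish n (suc k) (NP.m<n⇒m<1+n n<k)))
                  (⊗-zeroʳ (qpow (suc k))))

factor : ℕ → Poly
factor j = 𝟙 ⊕ scale (ℤ.- 1ℤ) (qpow j)

factor-telescope : ∀ a b → factor a ⊕ (qpow a ⊕ scale (ℤ.- 1ℤ) (qpow b)) ≋ factor b
factor-telescope a b = mk≋ λ k → begin
    coeff (factor a ⊕ (qpow a ⊕ scale -1ℤ (qpow b))) k
      ≡⟨ trans (coeff-⊕ (factor a) _ k) (cong₂ _+ℤ_ (coeff-factor a k)
               (trans (coeff-⊕ (qpow a) _ k) (cong (mono a k +ℤ_) (coeff-scale -1ℤ (qpow b) k)))) ⟩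
    (coeff 𝟙 k +ℤ -1ℤ ℤ.* mono a k) +ℤ (mono a k +ℤ -1ℤ ℤ.* mono b k)
      ≡⟨ cancel (coeff 𝟙 k) (mono a k) (mono b k) ⟩
    coeff 𝟙 k +ℤ -1ℤ ℤ.* mono b k
      ≡⟨ coeff-factor b k ⟨
    coeff (factor b) k ∎
  where
  open ≡-Reasoning
  -1ℤ = ℤ.- 1ℤ
  coeff-factor : ∀ j k → coeff (factor j) k ≡ coeff 𝟙 k +ℤ -1ℤ ℤ.* mono j k
  coeff-factor j k = trans (coeff-⊕ 𝟙 (scale -1ℤ (qpow j)) k) (cong (coeff 𝟙 k +ℤ_) (coeff-scale -1ℤ (qpow j) k))
  cancel : ∀ x y z → (x +ℤ -1ℤ ℤ.* y) +ℤ (y +ℤ -1ℤ ℤ.* z) ≡ x +ℤ -1ℤ ℤ.* z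
  cancel = ZS.solve 3 (λ x y z → (x ZS.:+ ZS.con -1ℤ ZS.:* y) ZS.:+ (y ZS.:+ ZS.con -1ℤ ZS.:* z)
                                  ZS.:= x ZS.:+ ZS.con -1ℤ ZS.:* z) refl

factor-split : ∀ d a → factor a ⊕ factor d ⊗ qpow a ≋ factor (d + a)
factor-split d a = ≋-trans (⊕-cong (≋-refl {factor a}) distribute) (factor-telescope a (d + a))
  where
  open PolyReasoning
  -1ℤ = ℤ.- 1ℤ
  distribute : factor d ⊗ qpow a ≋ qpow a ⊕ scale -1ℤ (qpow (d + a))
  distribute = begin
    (𝟙 ⊕ scale -1ℤ (qpow d)) ⊗ qpow a               ≈⟨ ⊗-distribʳ-⊕ 𝟙 (scale -1ℤ (qpow d)) (qpow a) ⟩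
    𝟙 ⊗ qpow a ⊕ scale -1ℤ (qpow d) ⊗ qpow a         ≈⟨ ⊕-cong (⊗-identityˡ (qpow a))
                                                           (≋-trans (scale-⊗ -1ℤ (qpow d) (qpow a))
                                                                    (scale-cong -1ℤ (qpow-+ d a))) ⟩
    qpow a ⊕ scale -1ℤ (qpow (d + a))                ∎

m∸n≡1+m∸1+n : ∀ m n → n < m → m ∸ n ≡ suc (m ∸ suc n)
m∸n≡1+m∸1+n (suc m) zero    _         = refl
m∸n≡1+m∸1+n (suc m) (suc n) (s≤s n<m) = m∸n≡1+m∸1+n m n n<m

pascal-first-term : ∀ m j → qPoch j ⊗ qPoch (m ∸ j) ⊗ gauss m j ≋ qPoch m →
  qPoch (suc j) ⊗ qPoch (m ∸ j) ⊗ gauss m j ≋ factor (suc j) ⊗ qPoch m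
pascal-first-term m j ih =
  ≋-trans (⊗-Solver.solve 4 (λ a e b g → ((a ⊕' e) ⊕' b) ⊕' g ⊜ e ⊕' ((a ⊕' b) ⊕' g)) ≋-refl
                            (qPoch j) (factor (suc j)) (qPoch (m ∸ j)) (gauss m j))
          (⊗-congʳ (factor (suc j)) ih)
  where open ⊗-Solver renaming (_⊕_ to _⊕'_)

pascal-second-term : ∀ m j → j < m →
  qPoch (suc j) ⊗ qPoch (m ∸ suc j) ⊗ gauss m (suc j) ≋ qPoch m →
  qPoch (suc j) ⊗ qPoch (m ∸ j) ⊗ (qpow (suc j) ⊗ gauss m (suc j)) ≋ (factor (m ∸ j) ⊗ qpow (suc j)) ⊗ qPoch m
pascal-second-term m j j<m ih = begin
    (qPoch (suc j) ⊗ qPoch (m ∸ j)) ⊗ (qpow (suc j) ⊗ gauss m (suc j))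
      ≈⟨ ≋-reflexive (cong (λ z → (qPoch (suc j) ⊗ qPoch z) ⊗ (qpow (suc j) ⊗ gauss m (suc j))) m-j) ⟩
    (qPoch (suc j) ⊗ (qPoch d ⊗ factor (suc d))) ⊗ (qpow (suc j) ⊗ gauss m (suc j))
      ≈⟨ ⊗-Solver.solve 5 (λ a b f x g → (a ⊕' (b ⊕' f)) ⊕' (x ⊕' g) ⊜ (f ⊕' x) ⊕' ((a ⊕' b) ⊕' g)) ≋-refl
           (qPoch (suc j)) (qPoch d) (factor (suc d)) (qpow (suc j)) (gauss m (suc j)) ⟩
    (factor (suc d) ⊗ qpow (suc j)) ⊗ ((qPoch (suc j) ⊗ qPoch d) ⊗ gauss m (suc j))
      ≈⟨ ⊗-cong (⊗-congˡ (qpow (suc j)) (≋-reflexive (cong factor (sym m-j)))) ih ⟩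
    (factor (m ∸ j) ⊗ qpow (suc j)) ⊗ qPoch m ∎
  where
  open PolyReasoning
  open ⊗-Solver using (_⊜_) renaming (_⊕_ to _⊕'_)
  d = m ∸ suc j
  m-j : m ∸ j ≡ suc d
  m-j = m∸n≡1+m∸1+n m j j<m

gauss-qPochhammer : ∀ n k → k ≤ n → qPoch k ⊗ qPoch (n ∸ k) ⊗ gauss n k ≋ qPoch n
gauss-qPochhammer n       zero    _         = ≋-trans (⊗-identityʳ _) (⊗-identityˡ (qPoch n))
gauss-qPochhammer (suc m) (suc j) (s≤s j≤m) =
  ≋-trans (⊗-distribˡ-⊕ X (gauss m j) (qpow (suc j) ⊗ gauss m (suc j)))
          (sum-of-terms (NP.m≤n⇒m<n∨m≡n j≤m))
  where
  open PolyReasoning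
  X = qPoch (suc j) ⊗ qPoch (m ∸ j)
  first = pascal-first-term m j (gauss-qPochhammer m j j≤m)
  sum-of-terms : j < m ⊎ j ≡ m → X ⊗ gauss m j ⊕ X ⊗ (qpow (suc j) ⊗ gauss m (suc j)) ≋ qPoch (suc m)
  sum-of-terms (inj₂ refl) = begin
      X ⊗ gauss j j ⊕ X ⊗ (qpow (suc j) ⊗ gauss j (suc j))
        ≈⟨ ⊕-cong first (≋-trans (⊗-congʳ X (≋-trans (⊗-congʳ (qpow (suc j)) (gauss-vanish j (suc j) (NP.n<1+n j)))
                                                     (⊗-zeroʳ (qpow (suc j)))))
                                  (⊗-zeroʳ X)) ⟩
      factor (suc j) ⊗ qPoch j ⊕ []   ≈⟨ ⊕-identityʳ _ ⟩
      factor (suc j) ⊗ qPoch j        ≈⟨ ⊗-comm (factor (suc j)) (qPoch j) ⟩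
      qPoch (suc j)                   ∎
  sum-of-terms (inj₁ j<m) = begin
      X ⊗ gauss m j ⊕ X ⊗ (qpow (suc j) ⊗ gauss m (suc j))
        ≈⟨ ⊕-cong first (pascal-second-term m j j<m (gauss-qPochhammer m (suc j) j<m)) ⟩
      factor (suc j) ⊗ qPoch m ⊕ (factor (m ∸ j) ⊗ qpow (suc j)) ⊗ qPoch m
        ≈⟨ ⊗-distribʳ-⊕ (factor (suc j)) (factor (m ∸ j) ⊗ qpow (suc j)) (qPoch m) ⟨
      (factor (suc j) ⊕ factor (m ∸ j) ⊗ qpow (suc j)) ⊗ qPoch m
        ≈⟨ ⊗-congˡ (qPoch m) (factor-split (m ∸ j) (suc j)) ⟩
      factor (m ∸ j + suc j) ⊗ qPoch m
        ≈⟨ ≋-reflexive (cong (λ z → factor z ⊗ qPoch m) (trans (NP.+-suc (m ∸ j) j) (cong suc (NP.m∸n+n≡m j≤m)))) ⟩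
      factor (suc m) ⊗ qPoch m        ≈⟨ ⊗-comm (factor (suc m)) (qPoch m) ⟩
      qPoch (suc m)                   ∎

gauss-isQBinom : ∀ n k → IsQBinom n k (gauss n k)
gauss-isQBinom n k with k ≤ᵇ n in eq
... | true  = get (gauss-qPochhammer n k (NP.≤ᵇ⇒≤ k n (subst B.T (sym eq) tt)))
... | false = get (gauss-vanish n k (NP.≰⇒> (λ le → subst B.T eq (NP.≤⇒≤ᵇ le))))

Gauss : ℕ → ℕ → Series
Gauss n k = coeff (gauss n k)

Gauss-cong : ∀ {n n' k k'} → n ≡ n' → k ≡ k' → Gauss n k ≐ Gauss n' k'
Gauss-cong refl refl = ≐-refl

Gauss-vanish : ∀ n k → n < k → Gauss n k ≐ 𝟘
Gauss-vanish n k lt = mk≐ (get (gauss-vanish n k lt))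

Gauss-diag : ∀ n → Gauss n n ≐ mono 0
Gauss-diag zero    = ≐-refl
Gauss-diag (suc n) = mk≐ (get (≋-trans (⊕-cong {gauss n n} {𝟙} (mk≋ (app (Gauss-diag n))) higher) (⊕-identityʳ 𝟙)))
  where
  higher : qpow (suc n) ⊗ gauss n (suc n) ≋ []
  higher = ≋-trans (⊗-congʳ (qpow (suc n)) (gauss-vanish n (suc n) (NP.n<1+n n))) (⊗-zeroʳ (qpow (suc n)))

Gauss-pascal : ∀ n k → Gauss (suc n) (suc k) ≐ Gauss n k ⊞ shift (suc k) (Gauss n (suc k))
Gauss-pascal n k = mk≐ λ i →
  trans (coeff-⊕ (gauss n k) (qpow (suc k) ⊗ gauss n (suc k)) i)
        (cong (Gauss n k i +ℤ_) (app (coeff-qpow-⊗ (suc k) (gauss n (suc k))) i))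

-- q^(j+2) q^(m-j-1) = q^(m-j) q^(j+1) on [m, j+1], which vanishes unless j < m.
pascal-exponents : ∀ m j →
  shift (suc (suc j)) (shift (m ∸ suc j) (Gauss m (suc j))) ≐ shift (m ∸ j) (shift (suc j) (Gauss m (suc j)))
pascal-exponents m j with suc j NP.≤? m
... | yes j<m = shift-merge (suc (suc j)) (m ∸ suc j) (m ∸ j) (suc j) (Gauss m (suc j)) (begin
      suc (suc j) + (m ∸ suc j)   ≡⟨ cong suc (NP.m+[n∸m]≡n j<m) ⟩
      suc m                       ≡⟨ cong suc (NP.m∸n+n≡m (NP.<⇒≤ j<m)) ⟨
      suc (m ∸ j + j)             ≡⟨ NP.+-suc (m ∸ j) j ⟨
      (m ∸ j) + suc j             ∎)
  where open ≡-Reasoning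
... | no j≮m = ≐-trans (shift-zero (suc (suc j)) (shift-zero (m ∸ suc j) vanish))
                       (≐-sym (shift-zero (m ∸ j) (shift-zero (suc j) vanish)))
  where
  vanish = Gauss-vanish m (suc j) (NP.≰⇒> j≮m)

Gauss-pascal′ : ∀ n k → Gauss (suc n) (suc k) ≐ shift (n ∸ k) (Gauss n k) ⊞ Gauss n (suc k)
Gauss-pascal′ zero    zero    = ≐-trans (Gauss-pascal 0 0) (⊞-congʳ (Gauss 0 0) (shift-𝟘 1))
Gauss-pascal′ zero    (suc k) = ≐-trans (Gauss-vanish 1 (suc (suc k)) (s≤s (s≤s z≤n))) (≐-sym (⊞-identityˡ 𝟘))
Gauss-pascal′ (suc m) zero    = begin
    Gauss (suc (suc m)) 1                               ≈⟨ Gauss-pascal (suc m) 0 ⟩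
    mono 0 ⊞ shift 1 (Gauss (suc m) 1)                  ≈⟨ ⊞-congʳ (mono 0) (shift-cong 1 (Gauss-pascal′ m 0)) ⟩
    mono 0 ⊞ shift 1 (shift m (Gauss m 0) ⊞ Gauss m 1)  ≈⟨ ⊞-congʳ (mono 0) (shift-⊞ 1 (shift m (Gauss m 0)) (Gauss m 1)) ⟩
    mono 0 ⊞ (shift (suc m) (mono 0) ⊞ shift 1 (Gauss m 1)) ≈⟨ ⊞-swapˡ (mono 0) (shift (suc m) (mono 0)) (shift 1 (Gauss m 1)) ⟩
    shift (suc m) (mono 0) ⊞ (mono 0 ⊞ shift 1 (Gauss m 1)) ≈⟨ ⊞-congʳ (shift (suc m) (mono 0)) (Gauss-pascal m 0) ⟨
    shift (suc m) (mono 0) ⊞ Gauss (suc m) 1            ∎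
  where open SeriesReasoning
Gauss-pascal′ (suc m) (suc j) = begin
    Gauss (suc (suc m)) (suc (suc j))                          ≈⟨ Gauss-pascal (suc m) (suc j) ⟩
    Gauss (suc m) (suc j) ⊞ shift (suc (suc j)) (Gauss (suc m) (suc (suc j)))
      ≈⟨ ⊞-cong (Gauss-pascal′ m j) (≐-trans (shift-cong (suc (suc j)) (Gauss-pascal′ m (suc j)))
                                             (shift-⊞ (suc (suc j)) (shift (m ∸ suc j) B) C)) ⟩
    (A ⊞ B) ⊞ (shift (suc (suc j)) (shift (m ∸ suc j) B) ⊞ shift (suc (suc j)) C)
      ≈⟨ ⊞-congʳ (A ⊞ B) (⊞-congˡ (shift (suc (suc j)) C) (pascal-exponents m j)) ⟩
    (A ⊞ B) ⊞ (shift (m ∸ j) (shift (suc j) B) ⊞ shift (suc (suc j)) C)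
      ≈⟨ ⊞-interchange A B (shift (m ∸ j) (shift (suc j) B)) (shift (suc (suc j)) C) ⟩
    (A ⊞ shift (m ∸ j) (shift (suc j) B)) ⊞ (B ⊞ shift (suc (suc j)) C)
      ≈⟨ ⊞-cong (≐-sym (shift-⊞ (m ∸ j) (Gauss m j) (shift (suc j) B))) (≐-sym (Gauss-pascal m (suc j))) ⟩
    shift (m ∸ j) (Gauss m j ⊞ shift (suc j) B) ⊞ Gauss (suc m) (suc (suc j))
      ≈⟨ ⊞-congˡ (Gauss (suc m) (suc (suc j))) (shift-cong (m ∸ j) (≐-sym (Gauss-pascal m j))) ⟩
    shift (m ∸ j) (Gauss (suc m) (suc j)) ⊞ Gauss (suc m) (suc (suc j)) ∎
  where
  open SeriesReasoning
  A = shift (m ∸ j) (Gauss m j)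
  B = Gauss m (suc j)
  C = Gauss m (suc (suc j))

-- Symmetry: the two Pascal rules are exchanged by k ↦ n - k.
Gauss-sym : ∀ n k → k ≤ n → Gauss n k ≐ Gauss n (n ∸ k)
Gauss-sym zero    zero    _         = ≐-refl
Gauss-sym (suc m) zero    _         = ≐-sym (Gauss-diag (suc m))
Gauss-sym (suc m) (suc j) (s≤s j≤m) with NP.m≤n⇒m<n∨m≡n j≤m
... | inj₂ refl = ≐-trans (Gauss-diag (suc j)) (Gauss-cong {suc j} refl (sym (NP.n∸n≡0 j)))
... | inj₁ j<m  = begin
    Gauss (suc m) (suc j)                               ≈⟨ Gauss-pascal m j ⟩
    Gauss m j ⊞ shift (suc j) (Gauss m (suc j))         ≈⟨ ⊞-comm (Gauss m j) (shift (suc j) (Gauss m (suc j))) ⟩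
    shift (suc j) (Gauss m (suc j)) ⊞ Gauss m j
      ≈⟨ ⊞-cong (≐-trans (shift-≡ (Gauss m (suc j)) (sym m∸d)) (shift-cong (m ∸ d) (Gauss-sym m (suc j) j<m)))
                (≐-trans (Gauss-sym m j j≤m) (Gauss-cong {m} refl m∸j)) ⟩
    shift (m ∸ d) (Gauss m d) ⊞ Gauss m (suc d)         ≈⟨ Gauss-pascal′ m d ⟨
    Gauss (suc m) (suc d)                               ≈⟨ Gauss-cong {suc m} refl (sym m∸j) ⟩
    Gauss (suc m) (m ∸ j)                               ∎
  where
  open SeriesReasoning
  d = m ∸ suc j
  m∸d : m ∸ d ≡ suc j
  m∸d = NP.m∸[m∸n]≡n j<m
  m∸j : m ∸ j ≡ suc d
  m∸j = m∸n≡1+m∸1+n m j j<m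

-- Closed forms.  closedF s t r = q^C(r+1,2) [s+t, s+r] is the claimed
-- value of F(s,t,r); closedU s t r = q^(C(r+1,2)+t-r) [s+t-1, s+r-1] that
-- of U(s,t,r), the part of F coming from paths not ending in a down
-- step.

tri : ℕ → ℕ
tri r = (r + 1) C 2

tri-suc : ∀ r → tri (suc r) ≡ suc r + tri r
tri-suc r = trans (sym (NC.nCk+nC[k+1]≡[n+1]C[k+1] (r + 1) 1))
                  (cong (_+ tri r) (trans (NC.nC1≡n (r + 1)) (NP.+-comm r 1)))

closedF : ℕ → ℕ → ℕ → Series
closedF s t r = shift (tri r) (Gauss (s + t) (s + r))

closedU : ℕ → ℕ → ℕ → Series
closedU s t r = shift (tri r) (shift (t ∸ r) (Gauss (pred (s + t)) (pred (s + r))))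

-- The value for paths with no down step: the only path has no returns,
-- so the sum is 1 if no marks are required and 0 otherwise.
noMarks : ℕ → Series
noMarks zero    = mono 0
noMarks (suc r) = 𝟘

closedF-t0 : ∀ s r → closedF s 0 r ≐ noMarks r
closedF-t0 s zero    = Gauss-diag (s + 0)
closedF-t0 s (suc r) = shift-zero (tri (suc r)) (Gauss-vanish (s + 0) (s + suc r) (NP.+-monoʳ-< s (s≤s z≤n)))

closedU-t0 : ∀ s r → closedU (suc s) 0 r ≐ noMarks r
closedU-t0 s zero    = Gauss-diag (s + 0)
closedU-t0 s (suc r) = shift-zero (tri (suc r)) (shift-zero 0 (Gauss-vanish (s + 0) (s + suc r) (NP.+-monoʳ-< s (s≤s z≤n))))

shift-merge⁺ : ∀ a b c d f → f ≐ 𝟘 ⊎ a + b ≡ c + d → shift a (shift b f) ≐ shift c (shift d f)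
shift-merge⁺ a b c d f (inj₁ z) = ≐-trans (shift-zero a (shift-zero b z)) (≐-sym (shift-zero c (shift-zero d z)))
shift-merge⁺ a b c d f (inj₂ e) = shift-merge a b c d f e

shift-merge₃⁺ : ∀ a b c d e f → f ≐ 𝟘 ⊎ a + (b + c) ≡ d + e →
  shift a (shift b (shift c f)) ≐ shift d (shift e f)
shift-merge₃⁺ a b c d e f (inj₁ z) =
  ≐-trans (shift-zero a (shift-zero b (shift-zero c z))) (≐-sym (shift-zero d (shift-zero e z)))
shift-merge₃⁺ a b c d e f (inj₂ eq) = shift-merge₃ a b c d e f eq

-- F(s+1,t+1,r) = U(s+1,t+1,r) + F(s+1,t,r): the second Pascal rule.
closedF-split : ∀ s t r → closedF (suc s) (suc t) r ≐ closedU (suc s) (suc t) r ⊞ closedF (suc s) t r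
closedF-split s t r = begin
    shift (tri r) (Gauss (suc (s + suc t)) (suc (s + r)))
      ≈⟨ shift-cong (tri r) (Gauss-pascal′ (s + suc t) (s + r)) ⟩
    shift (tri r) (shift ((s + suc t) ∸ (s + r)) (Gauss (s + suc t) (s + r)) ⊞ Gauss (s + suc t) (suc (s + r)))
      ≈⟨ shift-⊞ (tri r) _ _ ⟩
    shift (tri r) (shift ((s + suc t) ∸ (s + r)) (Gauss (s + suc t) (s + r))) ⊞ shift (tri r) (Gauss (s + suc t) (suc (s + r)))
      ≈⟨ ⊞-cong (shift-cong (tri r) (shift-≡ (Gauss (s + suc t) (s + r)) (NP.[m+n]∸[m+o]≡n∸o s (suc t) r)))
                (shift-cong (tri r) (Gauss-cong {k = suc (s + r)} (NP.+-suc s t) refl)) ⟩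
    shift (tri r) (shift (suc t ∸ r) (Gauss (s + suc t) (s + r))) ⊞ shift (tri r) (Gauss (suc (s + t)) (suc (s + r))) ∎
  where open SeriesReasoning

-- U(s+2,t+1,r) = U(s+1,t+1,r) + q^(s+t+2) F(s+1,t,r): the first Pascal rule.
closedU-step : ∀ s t r →
  closedU (suc (suc s)) (suc t) r ≐ closedU (suc s) (suc t) r ⊞ shift (suc s + suc t) (closedF (suc s) t r)
closedU-step s t r = begin
    shift (tri r) (shift (suc t ∸ r) (Gauss (suc N) (suc (s + r))))
      ≈⟨ shift-cong (tri r) (shift-cong (suc t ∸ r) (Gauss-pascal N (s + r))) ⟩
    shift (tri r) (shift (suc t ∸ r) (Gauss N (s + r) ⊞ shift (suc (s + r)) Z))
      ≈⟨ ≐-trans (shift-cong (tri r) (shift-⊞ (suc t ∸ r) (Gauss N (s + r)) (shift (suc (s + r)) Z))) (shift-⊞ (tri r) _ _) ⟩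
    shift (tri r) (shift (suc t ∸ r) (Gauss N (s + r))) ⊞ shift (tri r) (shift (suc t ∸ r) (shift (suc (s + r)) Z))
      ≈⟨ ⊞-congʳ (shift (tri r) (shift (suc t ∸ r) (Gauss N (s + r))))
           (≐-trans (shift-merge₃⁺ (tri r) (suc t ∸ r) (suc (s + r)) (suc s + suc t) (tri r) Z exponents)
                    (shift-cong (suc s + suc t) (shift-cong (tri r) (Gauss-cong {k = suc (s + r)} (NP.+-suc s t) refl)))) ⟩
    shift (tri r) (shift (suc t ∸ r) (Gauss N (s + r))) ⊞ shift (suc s + suc t) (shift (tri r) (Gauss (suc (s + t)) (suc (s + r)))) ∎
  where
  open SeriesReasoning
  N = s + suc t
  Z = Gauss N (suc (s + r))
  exponents : Z ≐ 𝟘 ⊎ tri r + ((suc t ∸ r) + suc (s + r)) ≡ suc s + suc t + tri r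
  exponents with r NP.≤? suc t
  ... | yes r≤t+1 = inj₂ (trans
          (NS.solve 4 (λ x u s r → x NS.:+ (u NS.:+ (NS.con 1 NS.:+ (s NS.:+ r)))
                                   NS.:= (NS.con 1 NS.:+ s) NS.:+ (r NS.:+ u) NS.:+ x) refl (tri r) (suc t ∸ r) s r)
          (cong (λ z → suc s + z + tri r) (NP.m+[n∸m]≡n r≤t+1)))
  ... | no r≰t+1 = inj₁ (Gauss-vanish N (suc (s + r)) (s≤s (NP.+-monoʳ-≤ s (NP.<⇒≤ (NP.≰⇒> r≰t+1)))))

-- U(t+2,t+1,r) = q^(2t+2) F(t+1,t,r) + q^(t+1) F(t+1,t,r-1): the first
-- Pascal rule at the middle coefficient, plus symmetry when r = 0.
closedU-diag : ∀ t r →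
  closedU (suc (suc t)) (suc t) r ≐ shift (suc t + suc t) (closedF (suc t) t r) ⊞ shift (suc t) (closedF (suc t) t (r ∸ 1))
closedU-diag t zero = begin
    shift τ (Gauss (τ + τ) (τ + 0))                   ≈⟨ shift-cong τ (Gauss-cong (cong suc (NP.+-suc t t)) (NP.+-identityʳ τ)) ⟩
    shift τ (Gauss (suc M) τ)                         ≈⟨ shift-cong τ (Gauss-pascal M t) ⟩
    shift τ (Gauss M t ⊞ shift τ (Gauss M τ))         ≈⟨ shift-cong τ (⊞-congˡ (shift τ (Gauss M τ))
                                                           (≐-trans (Gauss-sym M t (NP.m≤n⇒m≤1+n (NP.m≤m+n t t)))
                                                                    (Gauss-cong {M} refl (NP.m+n∸n≡m τ t)))) ⟩
    shift τ (Gauss M τ ⊞ shift τ (Gauss M τ))         ≈⟨ shift-⊞ τ (Gauss M τ) (shift τ (Gauss M τ)) ⟩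
    shift τ (Gauss M τ) ⊞ shift τ (shift τ (Gauss M τ)) ≈⟨ ⊞-comm (shift τ (Gauss M τ)) (shift τ (shift τ (Gauss M τ))) ⟩
    shift τ (shift τ (Gauss M τ)) ⊞ shift τ (Gauss M τ) ≈⟨ ⊞-cong (≐-reflexive (sym (shift-+ τ τ (Gauss M τ)))) ≐-refl ⟩
    shift (τ + τ) (Gauss M τ) ⊞ shift τ (Gauss M τ)   ≈⟨ ⊞-cong (shift-cong (τ + τ) τ≡τ+0) (shift-cong τ τ≡τ+0) ⟩
    shift (τ + τ) (Gauss M (τ + 0)) ⊞ shift τ (Gauss M (τ + 0)) ∎
  where
  open SeriesReasoning
  τ = suc t
  M = suc (t + t)
  τ≡τ+0 = Gauss-cong {M} refl (sym (NP.+-identityʳ τ))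
closedU-diag t (suc r) = begin
    shift (tri (suc r)) (shift (τ ∸ suc r) (Gauss (τ + τ) (τ + suc r)))
      ≈⟨ shift-cong (tri (suc r)) (shift-cong (τ ∸ suc r) (Gauss-cong (cong suc (NP.+-suc t t)) (NP.+-suc τ r))) ⟩
    shift (tri (suc r)) (shift (t ∸ r) (Gauss (suc M) (suc (τ + r))))
      ≈⟨ shift-cong (tri (suc r)) (shift-cong (t ∸ r) (Gauss-pascal M (τ + r))) ⟩
    shift (tri (suc r)) (shift (t ∸ r) (Gauss M (τ + r) ⊞ shift (suc (τ + r)) Z))
      ≈⟨ ≐-trans (shift-cong (tri (suc r)) (shift-⊞ (t ∸ r) (Gauss M (τ + r)) (shift (suc (τ + r)) Z)))
                 (shift-⊞ (tri (suc r)) _ _) ⟩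
    shift (tri (suc r)) (shift (t ∸ r) (Gauss M (τ + r))) ⊞ shift (tri (suc r)) (shift (t ∸ r) (shift (suc (τ + r)) Z))
      ≈⟨ ⊞-comm (shift (tri (suc r)) (shift (t ∸ r) (Gauss M (τ + r)))) _ ⟩
    shift (tri (suc r)) (shift (t ∸ r) (shift (suc (τ + r)) Z)) ⊞ shift (tri (suc r)) (shift (t ∸ r) (Gauss M (τ + r)))
      ≈⟨ ⊞-cong (≐-trans (shift-merge₃⁺ (tri (suc r)) (t ∸ r) (suc (τ + r)) (τ + τ) (tri (suc r)) Z marked-exponents)
                         (shift-cong (τ + τ) (shift-cong (tri (suc r)) (Gauss-cong {M} refl (sym (NP.+-suc τ r))))))
                (shift-merge⁺ (tri (suc r)) (t ∸ r) τ (tri r) (Gauss M (τ + r)) unmarked-exponents) ⟩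
    shift (τ + τ) (shift (tri (suc r)) (Gauss M (τ + suc r))) ⊞ shift τ (shift (tri r) (Gauss M (τ + r))) ∎
  where
  open SeriesReasoning
  τ = suc t
  M = suc (t + t)
  Z = Gauss M (suc (τ + r))
  unmarked-exponents : Gauss M (τ + r) ≐ 𝟘 ⊎ tri (suc r) + (t ∸ r) ≡ τ + tri r
  unmarked-exponents with r NP.≤? t
  ... | yes r≤t = inj₂ (trans (cong (_+ (t ∸ r)) (tri-suc r)) (trans
          (NS.solve 3 (λ r x u → NS.con 1 NS.:+ r NS.:+ x NS.:+ u NS.:= NS.con 1 NS.:+ (r NS.:+ u) NS.:+ x) refl r (tri r) (t ∸ r))
          (cong (λ z → suc z + tri r) (NP.m+[n∸m]≡n r≤t))))
  ... | no r≰t = inj₁ (Gauss-vanish M (τ + r) (s≤s (NP.+-monoʳ-< t (NP.≰⇒> r≰t))))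
  marked-exponents : Z ≐ 𝟘 ⊎ tri (suc r) + ((t ∸ r) + suc (τ + r)) ≡ τ + τ + tri (suc r)
  marked-exponents with r NP.≤? t
  ... | yes r≤t = inj₂ (trans
          (NS.solve 4 (λ x u t r → x NS.:+ (u NS.:+ (NS.con 1 NS.:+ ((NS.con 1 NS.:+ t) NS.:+ r)))
                                   NS.:= (NS.con 1 NS.:+ t) NS.:+ (NS.con 1 NS.:+ (r NS.:+ u)) NS.:+ x) refl (tri (suc r)) (t ∸ r) t r)
          (cong (λ z → τ + suc z + tri (suc r)) (NP.m+[n∸m]≡n r≤t)))
  ... | no r≰t = inj₁ (Gauss-vanish M (suc (τ + r)) (s≤s (s≤s (NP.+-monoʳ-≤ t (NP.<⇒≤ (NP.≰⇒> r≰t))))))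

length-∷ʳ : ∀ (l : List Bool) b → length (l ∷ʳ b) ≡ suc (length l)
length-∷ʳ []      b = refl
length-∷ʳ (x ∷ l) b = cong suc (length-∷ʳ l b)

at-∷ʳ-< : ∀ l b i → i < length l → at (l ∷ʳ b) i ≡ at l i
at-∷ʳ-< (x ∷ l) b zero    _        = refl
at-∷ʳ-< (x ∷ l) b (suc i) (s≤s lt) = at-∷ʳ-< l b i lt

at-∷ʳ-length : ∀ l b → at (l ∷ʳ b) (length l) ≡ b
at-∷ʳ-length []      b = refl
at-∷ʳ-length (x ∷ l) b = at-∷ʳ-length l b

at-≥ : ∀ l i → length l ≤ i → at l i ≡ false
at-≥ []      i       _        = refl
at-≥ (x ∷ l) (suc i) (s≤s le) = at-≥ l i le

isDown-∷ʳ-< : ∀ l b i → i < length l → isDown (l ∷ʳ b) i ≡ isDown l i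
isDown-∷ʳ-< (x ∷ l) b zero    _        = refl
isDown-∷ʳ-< (x ∷ l) b (suc i) (s≤s lt) = isDown-∷ʳ-< l b i lt

isDown-∷ʳ-length : ∀ l b → isDown (l ∷ʳ b) (length l) ≡ not b
isDown-∷ʳ-length []      true  = refl
isDown-∷ʳ-length []      false = refl
isDown-∷ʳ-length (x ∷ l) b     = isDown-∷ʳ-length l b

height-∷ʳ : ∀ l b i → i ≤ length l → height (l ∷ʳ b) i ≡ height l i
height-∷ʳ l b i le = cong endHeight (take-∷ʳ l i le)
  where
  take-∷ʳ : ∀ (l : List Bool) i → i ≤ length l → take i (l ∷ʳ b) ≡ take i l
  take-∷ʳ l       zero    _        = refl
  take-∷ʳ (x ∷ l) (suc i) (s≤s le) = cong (x ∷_) (take-∷ʳ l i le)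

height-length : ∀ l → height l (length l) ≡ endHeight l
height-length l = cong endHeight (LP.take-all (length l) l NP.≤-refl)

endsDown : Path → Bool
endsDown p = isDown p (pred (length p))

endsDown-∷ʳ : ∀ l b → endsDown (l ∷ʳ b) ≡ not b
endsDown-∷ʳ l b = trans (cong (λ n → isDown (l ∷ʳ b) (pred n)) (length-∷ʳ l b)) (isDown-∷ʳ-length l b)

valley-∷ʳ-< : ∀ l b i → i < length l → valleyᵇ (l ∷ʳ b) i ≡ valleyᵇ l i
valley-∷ʳ-< l b i lt = cong₂ (λ x y → (1 ≤ᵇ i) ∧ (x ∧ y))
  (isDown-∷ʳ-< l b (pred i) (NP.≤-<-trans NP.pred[n]≤n lt)) (at-∷ʳ-< l b i lt)

valley-∷ʳ-length : ∀ l b → valleyᵇ (l ∷ʳ b) (length l) ≡ endsDown l ∧ b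
valley-∷ʳ-length []      b = refl
valley-∷ʳ-length (x ∷ l) b = cong₂ _∧_ (isDown-∷ʳ-< (x ∷ l) b (length l) (NP.n<1+n _)) (at-∷ʳ-length l b)

valley-≥ : ∀ l i → length l ≤ i → valleyᵇ l i ≡ false
valley-≥ l i le = trans (cong (λ z → (1 ≤ᵇ i) ∧ (isDown l (pred i) ∧ z)) (at-≥ l i le))
  (trans (cong ((1 ≤ᵇ i) ∧_) (BP.∧-zeroʳ (isDown l (pred i)))) (BP.∧-zeroʳ (1 ≤ᵇ i)))

isZero : ℤ → Bool
isZero (+ zero)  = true
isZero (+ suc _) = false
isZero -[1+ _ ]  = false

return-unfold : ∀ p i → returnᵇ p i ≡ valleyᵇ p i ∧ isZero (height p i)
return-unfold p i with height p i
... | + zero   = refl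
... | + suc _  = refl
... | -[1+ _ ] = refl

return-∷ʳ-< : ∀ l b i → i < length l → returnᵇ (l ∷ʳ b) i ≡ returnᵇ l i
return-∷ʳ-< l b i lt = trans (return-unfold (l ∷ʳ b) i)
  (trans (cong₂ (λ x y → x ∧ isZero y) (valley-∷ʳ-< l b i lt) (height-∷ʳ l b i (NP.<⇒≤ lt)))
         (sym (return-unfold l i)))

return-∷ʳ-length : ∀ l b → returnᵇ (l ∷ʳ b) (length l) ≡ (endsDown l ∧ b) ∧ isZero (endHeight l)
return-∷ʳ-length l b = trans (return-unfold (l ∷ʳ b) (length l))
  (cong₂ (λ x y → x ∧ isZero y) (valley-∷ʳ-length l b) (trans (height-∷ʳ l b (length l) NP.≤-refl) (height-length l)))

return-≥ : ∀ l i → length l ≤ i → returnᵇ l i ≡ false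
return-≥ l i le = trans (return-unfold l i) (cong (_∧ isZero (height l i)) (valley-≥ l i le))

rangeSum : (ℕ → ℕ) → ℕ → ℕ
rangeSum f n = sum (map f (upTo n))

rangeSum-suc : ∀ f n → rangeSum f (suc n) ≡ rangeSum f n + f n
rangeSum-suc f n = trans (cong (λ xs → sum (map f xs)) (sym (LP.upTo-∷ʳ n)))
  (trans (cong sum (LP.map-++ f (upTo n) (n ∷ [])))
  (trans (SP.sum-++ (map f (upTo n)) (f n ∷ [])) (cong (_+_ (rangeSum f n)) (NP.+-identityʳ (f n)))))

rangeSum-cong : ∀ f g n → (∀ i → i < n → f i ≡ g i) → rangeSum f n ≡ rangeSum g n
rangeSum-cong f g zero    e = refl
rangeSum-cong f g (suc n) e = trans (rangeSum-suc f n)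
  (trans (cong₂ _+_ (rangeSum-cong f g n (λ i lt → e i (NP.m<n⇒m<1+n lt))) (e n (NP.n<1+n n)))
         (sym (rangeSum-suc g n)))

rangeSum-mono : ∀ f g n → (∀ i → i < n → f i ≤ g i) → rangeSum f n ≤ rangeSum g n
rangeSum-mono f g zero    e = z≤n
rangeSum-mono f g (suc n) e = subst₂ _≤_ (sym (rangeSum-suc f n)) (sym (rangeSum-suc g n))
  (NP.+-mono-≤ (rangeSum-mono f g n (λ i lt → e i (NP.m<n⇒m<1+n lt))) (e n (NP.n<1+n n)))

maj-∷ʳ : ∀ l b → maj (l ∷ʳ b) ≡ maj l + (if endsDown l ∧ b then length l else 0)
maj-∷ʳ l b = begin
    rangeSum v′ (suc (length (l ∷ʳ b)))   ≡⟨ cong (λ m → rangeSum v′ (suc m)) (length-∷ʳ l b) ⟩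
    rangeSum v′ (suc (suc n))             ≡⟨ rangeSum-suc v′ (suc n) ⟩
    rangeSum v′ (suc n) + v′ (suc n)      ≡⟨ cong₂ _+_ (rangeSum-suc v′ n)
                                               (cong (λ z → if z then suc n else 0) (valley-≥ (l ∷ʳ b) (suc n) (NP.≤-reflexive (length-∷ʳ l b)))) ⟩
    (rangeSum v′ n + v′ n) + 0            ≡⟨ NP.+-identityʳ _ ⟩
    rangeSum v′ n + v′ n                  ≡⟨ cong₂ _+_ (rangeSum-cong v′ v n (λ i lt → cong (λ z → if z then i else 0) (valley-∷ʳ-< l b i lt)))
                                                       (cong (λ z → if z then n else 0) (valley-∷ʳ-length l b)) ⟩
    rangeSum v n + new                    ≡⟨ cong (_+ new) last-is-no-valley ⟨
    rangeSum v (suc n) + new              ∎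
  where
  open ≡-Reasoning
  n = length l
  v′ v : ℕ → ℕ
  v′ i = if valleyᵇ (l ∷ʳ b) i then i else 0
  v  i = if valleyᵇ l i then i else 0
  new = if endsDown l ∧ b then length l else 0
  last-is-no-valley : rangeSum v (suc n) ≡ rangeSum v n
  last-is-no-valley = trans (rangeSum-suc v n)
    (trans (cong (_+_ (rangeSum v n)) (cong (λ z → if z then n else 0) (valley-≥ l n NP.≤-refl))) (NP.+-identityʳ _))

stepHeight : Bool → ℤ
stepHeight true  = 1ℤ
stepHeight false = ℤ.- 1ℤ

endHeight-∷ʳ : ∀ l b → endHeight (l ∷ʳ b) ≡ endHeight l +ℤ stepHeight b
endHeight-∷ʳ []          true  = refl
endHeight-∷ʳ []          false = refl
endHeight-∷ʳ (true ∷ l)  b = trans (cong (1ℤ +ℤ_) (endHeight-∷ʳ l b)) (sym (ZP.+-assoc 1ℤ (endHeight l) (stepHeight b)))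
endHeight-∷ʳ (false ∷ l) b = trans (cong (ℤ.- 1ℤ +ℤ_) (endHeight-∷ʳ l b)) (sym (ZP.+-assoc (ℤ.- 1ℤ) (endHeight l) (stepHeight b)))

∧-elimˡ : ∀ a b → a ∧ b ≡ true → a ≡ true
∧-elimˡ true b _ = refl

∧-elimʳ : ∀ a b → a ∧ b ≡ true → b ≡ true
∧-elimʳ true b e = e

allᵇ-++ : ∀ f xs ys → allᵇ f (xs ++ ys) ≡ allᵇ f xs ∧ allᵇ f ys
allᵇ-++ f []       ys = refl
allᵇ-++ f (x ∷ xs) ys = trans (cong (f x ∧_) (allᵇ-++ f xs ys)) (sym (BP.∧-assoc (f x) (allᵇ f xs) (allᵇ f ys)))

allᵇ-upTo-suc : ∀ f n → allᵇ f (upTo (suc n)) ≡ allᵇ f (upTo n) ∧ f n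
allᵇ-upTo-suc f n = trans (cong (allᵇ f) (sym (LP.upTo-∷ʳ n)))
  (trans (allᵇ-++ f (upTo n) (n ∷ [])) (cong (allᵇ f (upTo n) ∧_) (BP.∧-identityʳ (f n))))

allᵇ-upTo-cong : ∀ f g n → (∀ i → i < n → f i ≡ g i) → allᵇ f (upTo n) ≡ allᵇ g (upTo n)
allᵇ-upTo-cong f g zero    e = refl
allᵇ-upTo-cong f g (suc n) e = trans (allᵇ-upTo-suc f n)
  (trans (cong₂ _∧_ (allᵇ-upTo-cong f g n (λ i lt → e i (NP.m<n⇒m<1+n lt))) (e n (NP.n<1+n n)))
         (sym (allᵇ-upTo-suc g n)))

allᵇ-upTo-elim : ∀ f n i → allᵇ f (upTo n) ≡ true → i < n → f i ≡ true
allᵇ-upTo-elim f (suc n) i h lt with NP.m≤n⇒m<n∨m≡n (NP.≤-pred lt)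
... | inj₁ i<n  = allᵇ-upTo-elim f n i (∧-elimˡ _ _ (trans (sym (allᵇ-upTo-suc f n)) h)) i<n
... | inj₂ refl = ∧-elimʳ _ _ (trans (sym (allᵇ-upTo-suc f n)) h)

countTrue-∷ʳ : ∀ c y → countTrue (c ∷ʳ y) ≡ countTrue c + (if y then 1 else 0)
countTrue-∷ʳ []          true  = refl
countTrue-∷ʳ []          false = refl
countTrue-∷ʳ (true ∷ c)  y     = cong suc (countTrue-∷ʳ c y)
countTrue-∷ʳ (false ∷ c) y     = countTrue-∷ʳ c y

markedSum-∷ʳ : ∀ c y → markedSum (c ∷ʳ y) ≡ markedSum c + (if y then length c else 0)
markedSum-∷ʳ c y = begin
    rangeSum f′ (length (c ∷ʳ y))  ≡⟨ cong (rangeSum f′) (length-∷ʳ c y) ⟩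
    rangeSum f′ (suc n)            ≡⟨ rangeSum-suc f′ n ⟩
    rangeSum f′ n + f′ n           ≡⟨ cong₂ _+_ (rangeSum-cong f′ f n (λ i lt → cong (λ z → if z then i else 0) (at-∷ʳ-< c y i lt)))
                                                (cong (λ z → if z then n else 0) (at-∷ʳ-length c y)) ⟩
    rangeSum f n + (if y then n else 0) ∎
  where
  open ≡-Reasoning
  n = length c
  f′ f : ℕ → ℕ
  f′ i = if at (c ∷ʳ y) i then i else 0
  f  i = if at c i then i else 0

marksReturns : Path → List Bool → Bool
marksReturns p c = allᵇ (λ i → if at c i then returnᵇ p i else true) (upTo (length c))

marksReturns-∷ʳ : ∀ p c y → marksReturns p (c ∷ʳ y) ≡ marksReturns p c ∧ (if y then returnᵇ p (length c) else true)
marksReturns-∷ʳ p c y = trans (cong (allᵇ g′) (cong upTo (length-∷ʳ c y)))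
  (trans (allᵇ-upTo-suc g′ (length c))
  (cong₂ _∧_ (allᵇ-upTo-cong g′ g (length c) (λ i lt → cong (λ z → if z then returnᵇ p i else true) (at-∷ʳ-< c y i lt)))
             (cong (λ z → if z then returnᵇ p (length c) else true) (at-∷ʳ-length c y))))
  where
  g′ g : ℕ → Bool
  g′ i = if at (c ∷ʳ y) i then returnᵇ p i else true
  g  i = if at c i then returnᵇ p i else true

-- A marking of the first n points of l only sees returns of l, which
-- appending a step does not change.
marksReturns-path-∷ʳ : ∀ l b c → length c ≡ length l → marksReturns (l ∷ʳ b) c ≡ marksReturns l c
marksReturns-path-∷ʳ l b c e = allᵇ-upTo-cong _ _ (length c)
  (λ i lt → cong (if at c i then_else true) (return-∷ʳ-< l b i (subst (i <_) e lt)))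

-- Marked points are valleys, so their x-coordinates sum to at most maj.
markedSum≤maj : ∀ l c → length c ≡ length l → marksReturns l c ≡ true → markedSum c ≤ maj l
markedSum≤maj l c e h = NP.≤-trans (rangeSum-mono f v (length c) pointwise)
  (NP.≤-trans (NP.≤-reflexive (cong (rangeSum v) e))
              (subst (rangeSum v (length l) ≤_) (sym (rangeSum-suc v (length l))) (NP.m≤m+n _ _)))
  where
  f v : ℕ → ℕ
  f i = if at c i then i else 0
  v i = if valleyᵇ l i then i else 0
  marked⇒valley : ∀ (a w : Bool) i R → (if a then R else true) ≡ true → (R ≡ true → w ≡ true) →
    (if a then i else 0) ≤ (if w then i else 0)
  marked⇒valley true  w i R h k = subst (λ z → i ≤ (if z then i else 0)) (sym (k h)) NP.≤-refl
  marked⇒valley false w i R h k = z≤n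
  pointwise : ∀ i → i < length c → f i ≤ v i
  pointwise i lt = marked⇒valley (at c i) (valleyᵇ l i) i (returnᵇ l i) (allᵇ-upTo-elim _ (length c) i h lt)
    (λ r → ∧-elimˡ _ _ (trans (sym (return-unfold l i)) r))

half≤maj : ∀ l c → length c ≡ length l → marksReturns l c ≡ true → markedSum c / 2 ≤ maj l
half≤maj l c e h = NP.≤-trans (DM.m/n≤m (markedSum c) 2) (markedSum≤maj l c e h)

T⇒≡true : ∀ {b} → B.T b → b ≡ true
T⇒≡true {true} _ = refl

≡true⇒T : ∀ {b} → b ≡ true → B.T b
≡true⇒T refl = _

≢true⇒≡false : ∀ b → (b ≡ true → ⊥) → b ≡ false
≢true⇒≡false true  f = ⊥-elim (f refl)
≢true⇒≡false false f = refl

bool-ext : ∀ a b → (a ≡ true → b ≡ true) → (b ≡ true → a ≡ true) → a ≡ b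
bool-ext true  b     f g = sym (f refl)
bool-ext false true  f g = g refl
bool-ext false false f g = refl

∧-congʳ-under : ∀ a {b b′} → (a ≡ true → b ≡ b′) → a ∧ b ≡ a ∧ b′
∧-congʳ-under true  f = f refl
∧-congʳ-under false f = refl

ℤ≡ᵇ⇒≡ : ∀ x y → ℤ≡ᵇ x y ≡ true → x ≡ y
ℤ≡ᵇ⇒≡ (+ m)    (+ n)    e = cong +_ (NP.≡ᵇ⇒≡ m n (≡true⇒T e))
ℤ≡ᵇ⇒≡ -[1+ m ] -[1+ n ] e = cong -[1+_] (NP.≡ᵇ⇒≡ m n (≡true⇒T e))

≡⇒ℤ≡ᵇ : ∀ x y → x ≡ y → ℤ≡ᵇ x y ≡ true
≡⇒ℤ≡ᵇ (+ m)    _ refl = T⇒≡true (NP.≡⇒≡ᵇ m m refl)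
≡⇒ℤ≡ᵇ -[1+ m ] _ refl = T⇒≡true (NP.≡⇒≡ᵇ m m refl)

ℤ≡ᵇ-+ʳ : ∀ x y d → ℤ≡ᵇ (x +ℤ d) (y +ℤ d) ≡ ℤ≡ᵇ x y
ℤ≡ᵇ-+ʳ x y d = bool-ext _ _
  (λ h → ≡⇒ℤ≡ᵇ x y (cancel (ℤ≡ᵇ⇒≡ _ _ h)))
  (λ h → ≡⇒ℤ≡ᵇ _ _ (cong (_+ℤ d) (ℤ≡ᵇ⇒≡ x y h)))
  where
  undo : ∀ x → x ≡ (x +ℤ d) +ℤ ℤ.- d
  undo x = ZS.solve 2 (λ x d → x ZS.:= (x ZS.:+ d) ZS.:+ (ZS.:- d)) refl x d
  cancel : x +ℤ d ≡ y +ℤ d → x ≡ y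
  cancel e = trans (undo x) (trans (cong (_+ℤ ℤ.- d) e) (sym (undo y)))

diff-step : ∀ s t → (+ s) ℤ.- (+ suc t) ≡ ((+ s) ℤ.- (+ t)) +ℤ ℤ.- 1ℤ
diff-step s t = ZS.solve 2 (λ a b → a ZS.:- (ZS.con 1ℤ ZS.:+ b) ZS.:= (a ZS.:- b) ZS.:+ ZS.:- ZS.con 1ℤ) refl (+ s) (+ t)

diff-suc : ∀ s t → (+ suc s) ℤ.- (+ suc t) ≡ (+ s) ℤ.- (+ t)
diff-suc s t = ZS.solve 2 (λ a b → (ZS.con 1ℤ ZS.:+ a) ZS.:- (ZS.con 1ℤ ZS.:+ b) ZS.:= a ZS.:- b) refl (+ s) (+ t)

nonneg-diff : ∀ s t → nonnegᵇ ((+ s) ℤ.- (+ t)) ≡ (t ≤ᵇ s)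
nonneg-diff s       zero    = refl
nonneg-diff zero    (suc t) = refl
nonneg-diff (suc s) (suc t) = trans (cong nonnegᵇ (diff-suc s t)) (trans (nonneg-diff s t) (≤ᵇ-suc t s))
  where
  ≤ᵇ-suc : ∀ t s → (t ≤ᵇ s) ≡ (suc t ≤ᵇ suc s)
  ≤ᵇ-suc zero    s = refl
  ≤ᵇ-suc (suc t) s = refl

isZero-diff : ∀ s t → isZero ((+ s) ℤ.- (+ t)) ≡ (s ≡ᵇ t)
isZero-diff zero    zero    = refl
isZero-diff (suc s) zero    = refl
isZero-diff zero    (suc t) = refl
isZero-diff (suc s) (suc t) = trans (cong isZero (diff-suc s t)) (isZero-diff s t)

nonnegUpTo : Path → ℕ → Bool
nonnegUpTo p n = allᵇ (λ i → nonnegᵇ (height p i)) (upTo n)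

ballot-length : ∀ s t p → ballotᵇ s t p ≡ true → length p ≡ s + t
ballot-length s t p h = NP.≡ᵇ⇒≡ _ _ (≡true⇒T (∧-elimˡ _ _ h))

ballot-endHeight : ∀ s t p → ballotᵇ s t p ≡ true → endHeight p ≡ (+ s) ℤ.- (+ t)
ballot-endHeight s t p h = ℤ≡ᵇ⇒≡ _ _ (∧-elimˡ _ _ (∧-elimʳ (length p ≡ᵇ s + t) _ h))

ballot-endsOnAxis : ∀ s t l → ballotᵇ s t l ≡ true → isZero (endHeight l) ≡ (s ≡ᵇ t)
ballot-endsOnAxis s t l h = trans (cong isZero (ballot-endHeight s t l h)) (isZero-diff s t)

ups downs : Path → ℕ
ups []          = 0
ups (true ∷ p)  = suc (ups p)
ups (false ∷ p) = ups p
downs []          = 0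
downs (true ∷ p)  = downs p
downs (false ∷ p) = suc (downs p)

length-ups-downs : ∀ p → length p ≡ ups p + downs p
length-ups-downs []          = refl
length-ups-downs (true ∷ p)  = cong suc (length-ups-downs p)
length-ups-downs (false ∷ p) = trans (cong suc (length-ups-downs p)) (sym (NP.+-suc (ups p) (downs p)))

endHeight-ups-downs : ∀ p → endHeight p ≡ (+ ups p) ℤ.- (+ downs p)
endHeight-ups-downs []          = refl
endHeight-ups-downs (true ∷ p)  = trans (cong (1ℤ +ℤ_) (endHeight-ups-downs p))
  (ZS.solve 2 (λ a b → ZS.con 1ℤ ZS.:+ (a ZS.:- b) ZS.:= (ZS.con 1ℤ ZS.:+ a) ZS.:- b) refl (+ ups p) (+ downs p))
endHeight-ups-downs (false ∷ p) = trans (cong (ℤ.- 1ℤ +ℤ_) (endHeight-ups-downs p))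
  (ZS.solve 2 (λ a b → ZS.:- ZS.con 1ℤ ZS.:+ (a ZS.:- b) ZS.:= a ZS.:- (ZS.con 1ℤ ZS.:+ b)) refl (+ ups p) (+ downs p))

ups-∷ʳ-up : ∀ l → ups (l ∷ʳ true) ≡ suc (ups l)
ups-∷ʳ-up []          = refl
ups-∷ʳ-up (true ∷ l)  = cong suc (ups-∷ʳ-up l)
ups-∷ʳ-up (false ∷ l) = ups-∷ʳ-up l

downs-∷ʳ-down : ∀ l → downs (l ∷ʳ false) ≡ suc (downs l)
downs-∷ʳ-down []          = refl
downs-∷ʳ-down (true ∷ l)  = downs-∷ʳ-down l
downs-∷ʳ-down (false ∷ l) = cong suc (downs-∷ʳ-down l)

-- u + d = s + t and u - d = s - t give u = s.
ballot-ups : ∀ s t p → ballotᵇ s t p ≡ true → ups p ≡ s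
ballot-ups s t p h = halve u s (NP.+-cancelʳ-≡ (t + d) (u + u) (s + s) (begin
    u + u + (t + d)    ≡⟨ NS.solve 3 (λ u t d → u NS.:+ u NS.:+ (t NS.:+ d) NS.:= (u NS.:+ t) NS.:+ (u NS.:+ d)) refl u t d ⟩
    (u + t) + (u + d)  ≡⟨ cong₂ _+_ u+t≡s+d (trans (sym (length-ups-downs p)) (ballot-length s t p h)) ⟩
    (s + d) + (s + t)  ≡⟨ NS.solve 3 (λ s t d → (s NS.:+ d) NS.:+ (s NS.:+ t) NS.:= s NS.:+ s NS.:+ (t NS.:+ d)) refl s t d ⟩
    s + s + (t + d)    ∎))
  where
  open ≡-Reasoning
  u = ups p
  d = downs p
  halve : ∀ u s → u + u ≡ s + s → u ≡ s
  halve zero    zero    e = refl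
  halve (suc u) (suc s) e = cong suc (halve u s (NP.suc-injective
    (trans (sym (NP.+-suc u u)) (trans (NP.suc-injective e) (NP.+-suc s s)))))
  u-d≡s-t : (+ u) ℤ.- (+ d) ≡ (+ s) ℤ.- (+ t)
  u-d≡s-t = trans (sym (endHeight-ups-downs p)) (ballot-endHeight s t p h)
  add-back : ∀ a b c → a +ℤ c ≡ (a ℤ.- b) +ℤ b +ℤ c
  add-back = ZS.solve 3 (λ a b c → a ZS.:+ c ZS.:= (a ZS.:- b) ZS.:+ b ZS.:+ c) refl
  add-back′ : ∀ a b c → a +ℤ c ≡ (a ℤ.- b) +ℤ c +ℤ b
  add-back′ = ZS.solve 3 (λ a b c → a ZS.:+ c ZS.:= (a ZS.:- b) ZS.:+ c ZS.:+ b) refl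
  u+t≡s+d : u + t ≡ s + d
  u+t≡s+d = ZP.+-injective (trans (add-back (+ u) (+ d) (+ t))
    (trans (cong (λ z → z +ℤ (+ d) +ℤ (+ t)) u-d≡s-t) (sym (add-back′ (+ s) (+ t) (+ d)))))

ballot-downs : ∀ s t p → ballotᵇ s t p ≡ true → downs p ≡ t
ballot-downs s t p h = NP.+-cancelˡ-≡ s (downs p) t
  (trans (cong (_+ downs p) (sym (ballot-ups s t p h))) (trans (sym (length-ups-downs p)) (ballot-length s t p h)))

length-test-∷ʳ : ∀ l b n → (length (l ∷ʳ b) ≡ᵇ suc n) ≡ (length l ≡ᵇ n)
length-test-∷ʳ l b n = cong (_≡ᵇ suc n) (length-∷ʳ l b)

height-test-∷ʳ : ∀ l b x → ℤ≡ᵇ (endHeight (l ∷ʳ b)) (x +ℤ stepHeight b) ≡ ℤ≡ᵇ (endHeight l) x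
height-test-∷ʳ l b x = trans (cong (λ z → ℤ≡ᵇ z (x +ℤ stepHeight b)) (endHeight-∷ʳ l b)) (ℤ≡ᵇ-+ʳ (endHeight l) x (stepHeight b))

nonnegUpTo-∷ʳ : ∀ l b N → length l ≡ N →
  nonnegUpTo (l ∷ʳ b) (suc (suc N)) ≡ nonnegUpTo l (suc N) ∧ nonnegᵇ (endHeight l +ℤ stepHeight b)
nonnegUpTo-∷ʳ l b N e = trans (allᵇ-upTo-suc (nonnegAt (l ∷ʳ b)) (suc N))
  (cong₂ _∧_ (allᵇ-upTo-cong (nonnegAt (l ∷ʳ b)) (nonnegAt l) (suc N)
               (λ i lt → cong nonnegᵇ (height-∷ʳ l b i (subst (i ≤_) (sym e) (NP.≤-pred lt)))))
             (cong nonnegᵇ last-height))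
  where
  nonnegAt : Path → ℕ → Bool
  nonnegAt p i = nonnegᵇ (height p i)
  last-height : height (l ∷ʳ b) (suc N) ≡ endHeight l +ℤ stepHeight b
  last-height = trans (cong (height (l ∷ʳ b)) (sym (trans (length-∷ʳ l b) (cong suc e))))
                      (trans (height-length (l ∷ʳ b)) (endHeight-∷ʳ l b))

nonnegUpTo-length : ∀ l N → length l ≡ N → nonnegUpTo l (suc N) ≡ nonnegUpTo l N ∧ nonnegᵇ (endHeight l)
nonnegUpTo-length l N e = trans (allᵇ-upTo-suc _ N) (cong (nonnegUpTo l N ∧_) (cong nonnegᵇ (trans (cong (height l) (sym e)) (height-length l))))

ballot-∷ʳ-up : ∀ s t l → ballotᵇ (suc s) t (l ∷ʳ true) ≡ ballotᵇ s t l
ballot-∷ʳ-up s t l = begin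
    (length (l ∷ʳ true) ≡ᵇ suc N) ∧ (heightOK′ ∧ aboveAxis′)  ≡⟨ cong (_∧ (heightOK′ ∧ aboveAxis′)) (length-test-∷ʳ l true N) ⟩
    (length l ≡ᵇ N) ∧ (heightOK′ ∧ aboveAxis′)                ≡⟨ ∧-congʳ-under (length l ≡ᵇ N) (λ h → cong₂ _∧_
                                                                   (trans (cong (ℤ≡ᵇ (endHeight (l ∷ʳ true))) (diff+1 s t))
                                                                          (height-test-∷ʳ l true ((+ s) ℤ.- (+ t))))
                                                                   (nonneg-test (NP.≡ᵇ⇒≡ _ _ (≡true⇒T h)))) ⟩
    (length l ≡ᵇ N) ∧ (ℤ≡ᵇ (endHeight l) ((+ s) ℤ.- (+ t)) ∧ nonnegUpTo l (suc N)) ∎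
  where
  open ≡-Reasoning
  N = s + t
  heightOK′ = ℤ≡ᵇ (endHeight (l ∷ʳ true)) ((+ suc s) ℤ.- (+ t))
  aboveAxis′ = nonnegUpTo (l ∷ʳ true) (suc (suc N))
  diff+1 : ∀ s t → (+ suc s) ℤ.- (+ t) ≡ ((+ s) ℤ.- (+ t)) +ℤ 1ℤ
  diff+1 s t = ZS.solve 2 (λ a b → (ZS.con 1ℤ ZS.:+ a) ZS.:- b ZS.:= (a ZS.:- b) ZS.:+ ZS.con 1ℤ) refl (+ s) (+ t)
  -- a point one step above a nonnegative point is nonnegative
  absorb : ∀ X e → (X ∧ nonnegᵇ e) ∧ nonnegᵇ (e +ℤ 1ℤ) ≡ X ∧ nonnegᵇ e
  absorb X     (+ n)    = BP.∧-identityʳ _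
  absorb true  -[1+ n ] = refl
  absorb false -[1+ n ] = refl
  nonneg-test : length l ≡ N → nonnegUpTo (l ∷ʳ true) (suc (suc N)) ≡ nonnegUpTo l (suc N)
  nonneg-test e = trans (nonnegUpTo-∷ʳ l true N e) (trans (cong (_∧ nonnegᵇ (endHeight l +ℤ 1ℤ)) (nonnegUpTo-length l N e))
                    (trans (absorb (nonnegUpTo l N) (endHeight l)) (sym (nonnegUpTo-length l N e))))

ballot-∷ʳ-down : ∀ s t l → ballotᵇ s (suc t) (l ∷ʳ false) ≡ ballotᵇ s t l ∧ (t <ᵇ s)
ballot-∷ʳ-down s t l = begin
    (length (l ∷ʳ false) ≡ᵇ s + suc t) ∧ (heightOK′ ∧ aboveAxis′)
      ≡⟨ cong (_∧ (heightOK′ ∧ aboveAxis′)) (trans (cong (length (l ∷ʳ false) ≡ᵇ_) (NP.+-suc s t)) (length-test-∷ʳ l false N)) ⟩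
    (length l ≡ᵇ N) ∧ (heightOK′ ∧ aboveAxis′)
      ≡⟨ ∧-congʳ-under (length l ≡ᵇ N) (λ h → cong₂ _∧_ height-test (nonneg-test (NP.≡ᵇ⇒≡ _ _ (≡true⇒T h)))) ⟩
    (length l ≡ᵇ N) ∧ (heightOK ∧ (aboveAxis ∧ nonnegᵇ (endHeight l +ℤ ℤ.- 1ℤ)))
      ≡⟨ cong ((length l ≡ᵇ N) ∧_) (∧-congʳ-under heightOK last-point) ⟩
    (length l ≡ᵇ N) ∧ (heightOK ∧ (aboveAxis ∧ (t <ᵇ s)))
      ≡⟨ cong ((length l ≡ᵇ N) ∧_) (BP.∧-assoc heightOK aboveAxis (t <ᵇ s)) ⟨
    (length l ≡ᵇ N) ∧ ((heightOK ∧ aboveAxis) ∧ (t <ᵇ s))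
      ≡⟨ BP.∧-assoc (length l ≡ᵇ N) (heightOK ∧ aboveAxis) (t <ᵇ s) ⟨
    ((length l ≡ᵇ N) ∧ (heightOK ∧ aboveAxis)) ∧ (t <ᵇ s) ∎
  where
  open ≡-Reasoning
  N = s + t
  heightOK′ = ℤ≡ᵇ (endHeight (l ∷ʳ false)) ((+ s) ℤ.- (+ suc t))
  aboveAxis′ = nonnegUpTo (l ∷ʳ false) (suc (s + suc t))
  heightOK = ℤ≡ᵇ (endHeight l) ((+ s) ℤ.- (+ t))
  aboveAxis = nonnegUpTo l (suc N)
  height-test : heightOK′ ≡ heightOK
  height-test = trans (cong (ℤ≡ᵇ (endHeight (l ∷ʳ false))) (diff-step s t)) (height-test-∷ʳ l false ((+ s) ℤ.- (+ t)))
  nonneg-test : length l ≡ N → aboveAxis′ ≡ aboveAxis ∧ nonnegᵇ (endHeight l +ℤ ℤ.- 1ℤ)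
  nonneg-test e = trans (cong (λ z → nonnegUpTo (l ∷ʳ false) (suc z)) (NP.+-suc s t)) (nonnegUpTo-∷ʳ l false N e)
  last-point : heightOK ≡ true → aboveAxis ∧ nonnegᵇ (endHeight l +ℤ ℤ.- 1ℤ) ≡ aboveAxis ∧ (t <ᵇ s)
  last-point hB = cong (aboveAxis ∧_) (trans (cong (λ z → nonnegᵇ (z +ℤ ℤ.- 1ℤ)) (ℤ≡ᵇ⇒≡ (endHeight l) ((+ s) ℤ.- (+ t)) hB))
                                     (trans (cong nonnegᵇ (sym (diff-step s t))) (nonneg-diff s (suc t))))

ballot-∷ʳ-up-0 : ∀ t l → ballotᵇ 0 t (l ∷ʳ true) ≡ false
ballot-∷ʳ-up-0 t l = ≢true⇒≡false _ (λ h → 1+n≢0 (trans (sym (ups-∷ʳ-up l)) (ballot-ups 0 t (l ∷ʳ true) h)))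
  where
  1+n≢0 : ∀ {n} → suc n ≡ 0 → ⊥
  1+n≢0 ()

ballot-∷ʳ-down-0 : ∀ s l → ballotᵇ s 0 (l ∷ʳ false) ≡ false
ballot-∷ʳ-down-0 s l = ≢true⇒≡false _ (λ h → 1+n≢0 (trans (sym (downs-∷ʳ-down l)) (ballot-downs s 0 (l ∷ʳ false) h)))
  where
  1+n≢0 : ∀ {n} → suc n ≡ 0 → ⊥
  1+n≢0 ()

-- To
-- analyse it under appending a step, we generalise maj p to an
-- arbitrary weight W and sum over markings c of the first N points
-- only (the last point is never a return):
--   marksW  N p r W = Σ_c [c valid, ≥ r marks]  q^(W - Σc/2),
--   marksW⁺ N p r W = the same with point N marked as well.

marks : ℕ → Path → ℕ → Series
marks N p r = ∑ (λ m → when (validMarkingᵇ r p m) (mono (vmr (p , m)))) (allLists (suc N))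

markTerm : Path → ℕ → ℕ → List Bool → Series
markTerm p r W c = when (marksReturns p c ∧ (r ≤ᵇ countTrue c)) (mono (W ∸ markedSum c / 2))

marksW : ℕ → Path → ℕ → ℕ → Series
marksW N p r W = ∑ (markTerm p r W) (allLists N)

markTerm⁺ : ℕ → Path → ℕ → ℕ → List Bool → Series
markTerm⁺ N p r W c = when (marksReturns p c ∧ (r ≤ᵇ suc (countTrue c))) (mono (W ∸ (markedSum c + N) / 2))

marksW⁺ : ℕ → Path → ℕ → ℕ → Series
marksW⁺ N p r W = ∑ (markTerm⁺ N p r W) (allLists N)

countTrue-∷ʳ-false : ∀ c → countTrue (c ∷ʳ false) ≡ countTrue c
countTrue-∷ʳ-false c = trans (countTrue-∷ʳ c false) (NP.+-identityʳ _)

markedSum-∷ʳ-false : ∀ c → markedSum (c ∷ʳ false) ≡ markedSum c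
markedSum-∷ʳ-false c = trans (markedSum-∷ʳ c false) (NP.+-identityʳ _)

-- The end point of a path is not a valley, so it is never marked.
marks-unmarked-end : ∀ N p r → length p ≡ N → marks N p r ≐ marksW N p r (maj p)
marks-unmarked-end N p r ep = ≐-trans (∑-allLists-snoc term N) (∑-allLists-cong N _ _ split-last)
  where
  term : List Bool → Series
  term m = when (validMarkingᵇ r p m) (mono (vmr (p , m)))
  split-last : ∀ c → length c ≡ N → term (c ∷ʳ true) ⊞ term (c ∷ʳ false) ≐ markTerm p r (maj p) c
  split-last c ec = ≐-trans (⊞-cong (≐-reflexive end-marked) (≐-reflexive end-unmarked)) (⊞-identityˡ _)
    where
    end-invalid : marksReturns p (c ∷ʳ true) ≡ false
    end-invalid = trans (marksReturns-∷ʳ p c true)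
      (trans (cong (marksReturns p c ∧_) (return-≥ p (length c) (NP.≤-reflexive (trans ep (sym ec))))) (BP.∧-zeroʳ _))
    end-marked : term (c ∷ʳ true) ≡ 𝟘
    end-marked = cong (λ z → when (z ∧ (r ≤ᵇ countTrue (c ∷ʳ true))) (mono (vmr (p , c ∷ʳ true)))) end-invalid
    end-unmarked : term (c ∷ʳ false) ≡ markTerm p r (maj p) c
    end-unmarked = cong₂ (λ b w → when b (mono (maj p ∸ w / 2)))
      (cong₂ _∧_ (trans (marksReturns-∷ʳ p c false) (BP.∧-identityʳ _)) (cong (r ≤ᵇ_) (countTrue-∷ʳ-false c)))
      (markedSum-∷ʳ-false c)

marksW-∷ʳ : ∀ N l b r W → length l ≡ N →
  marksW (suc N) (l ∷ʳ b) r W ≐ marksW N l r W ⊞ when (returnᵇ (l ∷ʳ b) N) (marksW⁺ N l r W)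
marksW-∷ʳ N l b r W el = begin
    marksW (suc N) (l ∷ʳ b) r W                                       ≈⟨ ∑-allLists-snoc h N ⟩
    ∑ (λ c → h (c ∷ʳ true) ⊞ h (c ∷ʳ false)) (allLists N)             ≈⟨ ∑-allLists-cong N _ _ split-last ⟩
    ∑ (λ c → when R (markTerm⁺ N l r W c) ⊞ markTerm l r W c) (allLists N)
      ≈⟨ ∑-⊞ (λ c → when R (markTerm⁺ N l r W c)) (markTerm l r W) (allLists N) ⟩
    ∑ (λ c → when R (markTerm⁺ N l r W c)) (allLists N) ⊞ marksW N l r W
      ≈⟨ ⊞-congˡ (marksW N l r W) (∑-when R (markTerm⁺ N l r W) (allLists N)) ⟩
    when R (marksW⁺ N l r W) ⊞ marksW N l r W                         ≈⟨ ⊞-comm (when R (marksW⁺ N l r W)) (marksW N l r W) ⟩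
    marksW N l r W ⊞ when R (marksW⁺ N l r W)                         ∎
  where
  open SeriesReasoning
  h = markTerm (l ∷ʳ b) r W
  R = returnᵇ (l ∷ʳ b) N
  when-∧ : ∀ (a R q : Bool) X → when ((a ∧ R) ∧ q) X ≡ when R (when (a ∧ q) X)
  when-∧ true  true  q X = refl
  when-∧ true  false q X = refl
  when-∧ false true  q X = refl
  when-∧ false false q X = refl
  split-last : ∀ c → length c ≡ N → h (c ∷ʳ true) ⊞ h (c ∷ʳ false) ≐ when R (markTerm⁺ N l r W c) ⊞ markTerm l r W c
  split-last c ec = ⊞-cong (≐-reflexive marked) (≐-reflexive unmarked)
    where
    ecl : length c ≡ length l
    ecl = trans ec (sym el)
    unmarked : h (c ∷ʳ false) ≡ markTerm l r W c
    unmarked = cong₂ (λ b w → when b (mono (W ∸ w / 2)))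
      (cong₂ _∧_ (trans (marksReturns-∷ʳ (l ∷ʳ b) c false) (trans (BP.∧-identityʳ _) (marksReturns-path-∷ʳ l b c ecl)))
                 (cong (r ≤ᵇ_) (countTrue-∷ʳ-false c)))
      (markedSum-∷ʳ-false c)
    marked : h (c ∷ʳ true) ≡ when R (markTerm⁺ N l r W c)
    marked = trans (cong₂ (λ b w → when b (mono (W ∸ w / 2)))
        (cong₂ _∧_ (trans (marksReturns-∷ʳ (l ∷ʳ b) c true)
                          (cong₂ _∧_ (marksReturns-path-∷ʳ l b c ecl) (cong (returnᵇ (l ∷ʳ b)) ec)))
                   (cong (r ≤ᵇ_) (trans (countTrue-∷ʳ c true) (NP.+-comm (countTrue c) 1))))
        (trans (markedSum-∷ʳ c true) (cong (_+_ (markedSum c)) ec)))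
      (when-∧ (marksReturns l c) R (r ≤ᵇ suc (countTrue c)) (mono (W ∸ (markedSum c + N) / 2)))

when-mono-shift : ∀ (a q : Bool) (w₁ w₂ e : ℕ) → (a ≡ true → w₁ ≡ e + w₂) →
  when (a ∧ q) (mono w₁) ≐ shift e (when (a ∧ q) (mono w₂))
when-mono-shift false q     w₁ w₂ e h = ≐-sym (shift-𝟘 e)
when-mono-shift true  false w₁ w₂ e h = ≐-sym (shift-𝟘 e)
when-mono-shift true  true  w₁ w₂ e h = ≐-trans (≐-reflexive (cong mono (h refl))) (≐-sym (shift-mono e w₂))

-- A new valley at x = e (unmarked) multiplies by q^e, since maj ≥ Σc/2.
marksW-shift : ∀ N l r e → length l ≡ N → marksW N l r (maj l + e) ≐ shift e (marksW N l r (maj l))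
marksW-shift N l r e el = ≐-trans (∑-allLists-cong N _ _ termwise) (∑-shift e (markTerm l r (maj l)) (allLists N))
  where
  termwise : ∀ c → length c ≡ N → markTerm l r (maj l + e) c ≐ shift e (markTerm l r (maj l) c)
  termwise c ec = when-mono-shift (marksReturns l c) (r ≤ᵇ countTrue c) _ _ e
    (λ hA → trans (NP.+-∸-comm e (half≤maj l c (trans ec (sym el)) hA)) (NP.+-comm _ e))

-- A new marked return at x = 2t adds 2t - t = t to vmr and one mark.
marksW⁺-shift : ∀ t l r → length l ≡ t + t →
  marksW⁺ (t + t) l r (maj l + (t + t)) ≐ shift t (marksW (t + t) l (r ∸ 1) (maj l))
marksW⁺-shift t l r el = ≐-trans (∑-allLists-cong (t + t) _ _ termwise) (∑-shift t (markTerm l (r ∸ 1) (maj l)) (allLists (t + t)))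
  where
  one-mark-used : ∀ r k → (r ≤ᵇ suc k) ≡ (r ∸ 1 ≤ᵇ k)
  one-mark-used zero          k = refl
  one-mark-used (suc zero)    k = refl
  one-mark-used (suc (suc r)) k = refl
  half-2t : ∀ x → (x + (t + t)) / 2 ≡ x / 2 + t
  half-2t x = trans (DM.+-distrib-/-∣ʳ x (DV.divides t t+t≡t*2))
                    (cong (_+_ (x / 2)) (trans (cong (_/ 2) t+t≡t*2) (DM.m*n/n≡m t 2)))
    where
    t+t≡t*2 : t + t ≡ t ℕ.* 2
    t+t≡t*2 = NS.solve 1 (λ t → t NS.:+ t NS.:= t NS.:* NS.con 2) refl t
  termwise : ∀ c → length c ≡ t + t → markTerm⁺ (t + t) l r (maj l + (t + t)) c ≐ shift t (markTerm l (r ∸ 1) (maj l) c)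
  termwise c ec = ≐-trans
    (≐-reflexive (cong (λ z → when (marksReturns l c ∧ z) (mono ((maj l + (t + t)) ∸ (markedSum c + (t + t)) / 2)))
                       (one-mark-used r (countTrue c))))
    (when-mono-shift (marksReturns l c) (r ∸ 1 ≤ᵇ countTrue c) _ _ t weight)
    where
    weight : marksReturns l c ≡ true → (maj l + (t + t)) ∸ (markedSum c + (t + t)) / 2 ≡ t + (maj l ∸ markedSum c / 2)
    weight hA = begin
        (maj l + (t + t)) ∸ (markedSum c + (t + t)) / 2
          ≡⟨ cong₂ _∸_ (NS.solve 2 (λ m t → m NS.:+ (t NS.:+ t) NS.:= t NS.:+ (m NS.:+ t)) refl (maj l) t)
                       (trans (half-2t (markedSum c)) (NP.+-comm _ t)) ⟩
        (t + (maj l + t)) ∸ (t + markedSum c / 2)   ≡⟨ NP.[m+n]∸[m+o]≡n∸o t (maj l + t) (markedSum c / 2) ⟩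
        (maj l + t) ∸ markedSum c / 2               ≡⟨ NP.+-∸-comm t (half≤maj l c (trans ec (sym el)) hA) ⟩
        (maj l ∸ markedSum c / 2) + t               ≡⟨ NP.+-comm _ t ⟩
        t + (maj l ∸ markedSum c / 2)               ∎
      where open ≡-Reasoning

-- Let β say that
-- this creates a valley (l ends down, b is up); the valley is at
-- x = s+t and is a return iff s = t.  Unmarked it multiplies by
-- q^(s+t); marked it contributes q^t and one of the r marks.
marks-∷ʳ : ∀ s t l b r β → ballotᵇ s t l ≡ true → endsDown l ∧ b ≡ β →
  marks (suc (s + t)) (l ∷ʳ b) r ≐
    shift (if β then s + t else 0) (marks (s + t) l r) ⊞ when (β ∧ (s ≡ᵇ t)) (shift t (marks (s + t) l (r ∸ 1)))
marks-∷ʳ s t l b r β ballot refl = begin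
    marks (suc N) (l ∷ʳ b) r                                 ≈⟨ marks-unmarked-end (suc N) (l ∷ʳ b) r (trans (length-∷ʳ l b) (cong suc el)) ⟩
    marksW (suc N) (l ∷ʳ b) r W                              ≈⟨ marksW-∷ʳ N l b r W el ⟩
    marksW N l r W ⊞ when (returnᵇ (l ∷ʳ b) N) (marksW⁺ N l r W)
      ≈⟨ ⊞-cong (≐-trans (≐-reflexive (cong (marksW N l r) maj-new)) (marksW-shift N l r _ el))
                (≐-reflexive (cong (λ z → when z (marksW⁺ N l r W)) new-return)) ⟩
    shift e (marksW N l r (maj l)) ⊞ when (β ∧ (s ≡ᵇ t)) (marksW⁺ N l r W)
      ≈⟨ ⊞-cong (shift-cong e (≐-sym (marks-unmarked-end N l r el))) (when-cong-under (β ∧ (s ≡ᵇ t)) marked-return) ⟩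
    shift e (marks N l r) ⊞ when (β ∧ (s ≡ᵇ t)) (shift t (marks N l (r ∸ 1))) ∎
  where
  open SeriesReasoning
  N = s + t
  W = maj (l ∷ʳ b)
  e = if β then N else 0
  el : length l ≡ N
  el = ballot-length s t l ballot
  maj-new : W ≡ maj l + e
  maj-new = trans (maj-∷ʳ l b) (cong (λ x → maj l + (if β then x else 0)) el)
  new-return : returnᵇ (l ∷ʳ b) N ≡ β ∧ (s ≡ᵇ t)
  new-return = trans (cong (returnᵇ (l ∷ʳ b)) (sym el))
                     (trans (return-∷ʳ-length l b) (cong (β ∧_) (ballot-endsOnAxis s t l ballot)))
  diagonal : s ≡ t → length l ≡ s + t → marksW⁺ (s + t) l r (maj l + (s + t)) ≐ shift t (marksW (s + t) l (r ∸ 1) (maj l))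
  diagonal refl = marksW⁺-shift s l r
  marked-return : β ∧ (s ≡ᵇ t) ≡ true → marksW⁺ N l r W ≐ shift t (marks N l (r ∸ 1))
  marked-return h =
    ≐-trans (≐-reflexive (cong (marksW⁺ N l r) (trans maj-new (cong (λ x → maj l + (if x then N else 0)) (∧-elimˡ β _ h)))))
    (≐-trans (diagonal (NP.≡ᵇ⇒≡ s t (≡true⇒T (∧-elimʳ β _ h))) el) (shift-cong t (≐-sym (marks-unmarked-end N l (r ∸ 1) el))))

genN upN downN : ℕ → ℕ → ℕ → ℕ → Series
genN  N s t r = ∑ (λ p → when (ballotᵇ s t p) (marks N p r)) (allLists N)
upN   N s t r = ∑ (λ p → when (ballotᵇ s t p ∧ not (endsDown p)) (marks N p r)) (allLists N)
downN N s t r = ∑ (λ p → when (ballotᵇ s t p ∧ endsDown p) (marks N p r)) (allLists N)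

gen genUp genDown : ℕ → ℕ → ℕ → Series
gen     s t r = genN  (s + t) s t r
genUp   s t r = upN   (s + t) s t r
genDown s t r = downN (s + t) s t r

gen-split : ∀ s t r → gen s t r ≐ genUp s t r ⊞ genDown s t r
gen-split s t r = ≐-trans (∑-cong (allLists (s + t)) (λ p → when-split (ballotᵇ s t p) (endsDown p) (marks (s + t) p r)))
  (∑-⊞ (λ p → when (ballotᵇ s t p ∧ not (endsDown p)) (marks (s + t) p r))
       (λ p → when (ballotᵇ s t p ∧ endsDown p) (marks (s + t) p r)) (allLists (s + t)))

-- Paths ending with a down step to (s, t+1) are paths to (s, t)
-- followed by a down step, which is allowed iff t < s, and which
-- changes neither valleys nor returns.
genDown-recurrence : ∀ s t r → genDown s (suc t) r ≐ when (t <ᵇ s) (gen s t r)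
genDown-recurrence s t r = begin
    downN (s + suc t) s (suc t) r                                  ≈⟨ ≐-reflexive (cong (λ M → downN M s (suc t) r) (NP.+-suc s t)) ⟩
    downN (suc N) s (suc t) r                                      ≈⟨ ∑-allLists-snoc hD N ⟩
    ∑ (λ l → hD (l ∷ʳ true) ⊞ hD (l ∷ʳ false)) (allLists N)        ≈⟨ ∑-cong (allLists N) per-path ⟩
    ∑ (λ l → when q (when (ballotᵇ s t l) (marks N l r))) (allLists N) ≈⟨ ∑-when q (λ l → when (ballotᵇ s t l) (marks N l r)) (allLists N) ⟩
    when q (gen s t r)                                             ∎
  where
  open SeriesReasoning
  N = s + t
  q = t <ᵇ s
  hD : Path → Series
  hD p = when (ballotᵇ s (suc t) p ∧ endsDown p) (marks (suc N) p r)
  per-path : ∀ l → hD (l ∷ʳ true) ⊞ hD (l ∷ʳ false) ≐ when q (when (ballotᵇ s t l) (marks N l r))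
  per-path l = ≐-trans (⊞-cong (≐-reflexive up-last) (≐-reflexive down-last))
                       (≐-trans (⊞-identityˡ _) (by-ballot (ballotᵇ s t l) refl))
    where
    up-last : hD (l ∷ʳ true) ≡ 𝟘
    up-last = cong (λ z → when z (marks (suc N) (l ∷ʳ true) r))
      (trans (cong (ballotᵇ s (suc t) (l ∷ʳ true) ∧_) (endsDown-∷ʳ l true)) (BP.∧-zeroʳ _))
    down-last : hD (l ∷ʳ false) ≡ when (ballotᵇ s t l ∧ q) (marks (suc N) (l ∷ʳ false) r)
    down-last = cong (λ z → when z (marks (suc N) (l ∷ʳ false) r))
      (trans (cong₂ _∧_ (ballot-∷ʳ-down s t l) (endsDown-∷ʳ l false)) (BP.∧-identityʳ _))
    by-ballot : ∀ b → ballotᵇ s t l ≡ b → when (b ∧ q) (marks (suc N) (l ∷ʳ false) r) ≐ when q (when b (marks N l r))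
    by-ballot false _ = ≐-sym (when-𝟘 q)
    by-ballot true  h = when-cong q (≐-trans (marks-∷ʳ s t l false r false h (BP.∧-zeroʳ _)) (⊞-identityʳ (marks N l r)))

marks-∷ʳ-up : ∀ s t l r → ballotᵇ s t l ≡ true →
  marks (suc (s + t)) (l ∷ʳ true) r ≐
    (when (not (endsDown l)) (marks (s + t) l r) ⊞ shift (s + t) (when (endsDown l) (marks (s + t) l r)))
    ⊞ when (s ≡ᵇ t) (shift t (when (endsDown l) (marks (s + t) l (r ∸ 1))))
marks-∷ʳ-up s t l r h with endsDown l in ends
... | false = ≐-trans (marks-∷ʳ s t l true r false h (cong (_∧ true) ends))
  (≐-trans (⊞-identityʳ (marks N l r))
  (≐-sym (≐-trans (⊞-cong (≐-trans (⊞-congʳ (marks N l r) (shift-𝟘 N)) (⊞-identityʳ (marks N l r)))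
                           (≐-trans (when-cong (s ≡ᵇ t) (shift-𝟘 t)) (when-𝟘 (s ≡ᵇ t))))
                  (⊞-identityʳ (marks N l r)))))
  where N = s + t
... | true  = ≐-trans (marks-∷ʳ s t l true r true h (cong (_∧ true) ends))
  (≐-sym (⊞-congˡ _ (⊞-identityˡ (shift (s + t) (marks (s + t) l r)))))

genUp-recurrence : ∀ s t r →
  genUp (suc s) t r ≐ genUp s t r ⊞ shift (s + t) (genDown s t r) ⊞ when (s ≡ᵇ t) (shift t (genDown s t (r ∸ 1)))
genUp-recurrence s t r = begin
    upN (suc N) (suc s) t r                                    ≈⟨ ∑-allLists-snoc hU N ⟩
    ∑ (λ l → hU (l ∷ʳ true) ⊞ hU (l ∷ʳ false)) (allLists N)    ≈⟨ ∑-cong (allLists N) per-path ⟩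
    ∑ (λ l → (u l ⊞ shift N (d r l)) ⊞ when ζ (shift t (d (r ∸ 1) l))) (allLists N)
      ≈⟨ ∑-⊞ (λ l → u l ⊞ shift N (d r l)) (λ l → when ζ (shift t (d (r ∸ 1) l))) (allLists N) ⟩
    ∑ (λ l → u l ⊞ shift N (d r l)) (allLists N) ⊞ ∑ (λ l → when ζ (shift t (d (r ∸ 1) l))) (allLists N)
      ≈⟨ ⊞-cong (≐-trans (∑-⊞ u (λ l → shift N (d r l)) (allLists N)) (⊞-congʳ (upN N s t r) (∑-shift N (d r) (allLists N))))
                (≐-trans (∑-when ζ (λ l → shift t (d (r ∸ 1) l)) (allLists N)) (when-cong ζ (∑-shift t (d (r ∸ 1)) (allLists N)))) ⟩
    upN N s t r ⊞ shift N (downN N s t r) ⊞ when ζ (shift t (downN N s t (r ∸ 1))) ∎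
  where
  open SeriesReasoning
  N = s + t
  ζ = s ≡ᵇ t
  hU u : Path → Series
  hU p = when (ballotᵇ (suc s) t p ∧ not (endsDown p)) (marks (suc N) p r)
  u  l = when (ballotᵇ s t l ∧ not (endsDown l)) (marks N l r)
  d : ℕ → Path → Series
  d r′ l = when (ballotᵇ s t l ∧ endsDown l) (marks N l r′)
  per-path : ∀ l → hU (l ∷ʳ true) ⊞ hU (l ∷ʳ false) ≐ (u l ⊞ shift N (d r l)) ⊞ when ζ (shift t (d (r ∸ 1) l))
  per-path l = ≐-trans (⊞-cong (≐-reflexive up-last) (≐-reflexive down-last)) (≐-trans (⊞-identityʳ _) (by-ballot (ballotᵇ s t l) refl))
    where
    down-last : hU (l ∷ʳ false) ≡ 𝟘
    down-last = cong (λ z → when z (marks (suc N) (l ∷ʳ false) r))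
      (trans (cong (λ z → ballotᵇ (suc s) t (l ∷ʳ false) ∧ not z) (endsDown-∷ʳ l false)) (BP.∧-zeroʳ _))
    up-last : hU (l ∷ʳ true) ≡ when (ballotᵇ s t l) (marks (suc N) (l ∷ʳ true) r)
    up-last = cong (λ z → when z (marks (suc N) (l ∷ʳ true) r))
      (trans (cong₂ (λ x y → x ∧ not y) (ballot-∷ʳ-up s t l) (endsDown-∷ʳ l true)) (BP.∧-identityʳ _))
    by-ballot : ∀ b → ballotᵇ s t l ≡ b → when b (marks (suc N) (l ∷ʳ true) r) ≐ (u l ⊞ shift N (d r l)) ⊞ when ζ (shift t (d (r ∸ 1) l))
    by-ballot true  h rewrite h = marks-∷ʳ-up s t l r h
    by-ballot false h rewrite h = ≐-sym (⊞-zero (⊞-zero ≐-refl (shift-𝟘 N)) (≐-trans (when-cong ζ (shift-𝟘 t)) (when-𝟘 ζ)))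

genUp-origin : ∀ r → genUp 0 0 r ≐ noMarks r
genUp-origin zero    = mk≐ λ k → trans (ZP.+-identityʳ _) (trans (ZP.+-identityˡ _) (ZP.+-identityʳ _))
genUp-origin (suc r) = mk≐ λ k → trans (ZP.+-identityʳ _) (trans (ZP.+-identityˡ _) (ZP.+-identityʳ _))

genDown-t0 : ∀ s r → genDown s 0 r ≐ 𝟘
genDown-t0 s r = ≐-trans (≐-reflexive (cong (λ N → downN N s 0 r) (NP.+-identityʳ s))) (vanish s)
  where
  vanish : ∀ s → downN s s 0 r ≐ 𝟘
  vanish zero    = ⊞-identityˡ 𝟘
  vanish (suc s) = ≐-trans (∑-allLists-snoc hD s) (≐-trans (∑-cong (allLists s) per-path) (∑-𝟘 (allLists s)))
    where
    hD : Path → Series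
    hD p = when (ballotᵇ (suc s) 0 p ∧ endsDown p) (marks (suc s) p r)
    per-path : ∀ l → hD (l ∷ʳ true) ⊞ hD (l ∷ʳ false) ≐ 𝟘
    per-path l = ⊞-zero
      (≐-reflexive (cong (λ z → when z (marks (suc s) (l ∷ʳ true) r))
                         (trans (cong (ballotᵇ (suc s) 0 (l ∷ʳ true) ∧_) (endsDown-∷ʳ l true)) (BP.∧-zeroʳ _))))
      (≐-reflexive (cong (λ z → when z (marks (suc s) (l ∷ʳ false) r))
                         (cong (_∧ endsDown (l ∷ʳ false)) (ballot-∷ʳ-down-0 (suc s) l))))

genUp-s0 : ∀ t r → genUp 0 (suc t) r ≐ 𝟘
genUp-s0 t r = ≐-trans (∑-allLists-snoc hU t) (≐-trans (∑-cong (allLists t) per-path) (∑-𝟘 (allLists t)))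
  where
  hU : Path → Series
  hU p = when (ballotᵇ 0 (suc t) p ∧ not (endsDown p)) (marks (suc t) p r)
  per-path : ∀ l → hU (l ∷ʳ true) ⊞ hU (l ∷ʳ false) ≐ 𝟘
  per-path l = ⊞-zero
    (≐-reflexive (cong (λ z → when z (marks (suc t) (l ∷ʳ true) r))
                       (cong (_∧ not (endsDown (l ∷ʳ true))) (ballot-∷ʳ-up-0 (suc t) l))))
    (≐-reflexive (cong (λ z → when z (marks (suc t) (l ∷ʳ false) r))
                       (trans (cong (λ z → ballotᵇ 0 (suc t) (l ∷ʳ false) ∧ not z) (endsDown-∷ʳ l false)) (BP.∧-zeroʳ _))))

≤⇒<ᵇ-false : ∀ {s t} → s ≤ t → (t <ᵇ s) ≡ false
≤⇒<ᵇ-false {s} {t} le = ≢true⇒≡false _ (λ h → NP.≤⇒≯ le (NP.<ᵇ⇒< t s (≡true⇒T h)))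

<⇒<ᵇ-true : ∀ {s t} → t < s → (t <ᵇ s) ≡ true
<⇒<ᵇ-true lt = T⇒≡true (NP.<⇒<ᵇ lt)

≢⇒≡ᵇ-false : ∀ {s t} → (s ≡ t → ⊥) → (s ≡ᵇ t) ≡ false
≢⇒≡ᵇ-false {s} {t} ne = ≢true⇒≡false _ (λ h → ne (NP.≡ᵇ⇒≡ s t (≡true⇒T h)))

genDown-vanish : ∀ s t r → s < t → genDown s t r ≐ 𝟘
genDown-vanish s (suc t) r lt = ≐-trans (genDown-recurrence s t r) (when-false (gen s t r) (≤⇒<ᵇ-false (NP.≤-pred lt)))

genUp-vanish : ∀ s t r → s < t → genUp s t r ≐ 𝟘
genUp-vanish zero    (suc t) r _  = genUp-s0 t r
genUp-vanish (suc s) t       r lt = ≐-trans (genUp-recurrence s t r)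
  (⊞-zero (⊞-zero (genUp-vanish s t r s<t) (shift-zero (s + t) (genDown-vanish s t r s<t)))
          (when-false (shift t (genDown s t (r ∸ 1))) (≢⇒≡ᵇ-false (NP.<⇒≢ s<t))))
  where
  s<t = NP.<-trans (NP.n<1+n s) lt

genUp-dyck : ∀ t r → genUp (suc t) (suc t) r ≐ 𝟘
genUp-dyck t r = ≐-trans (genUp-recurrence t (suc t) r)
  (⊞-zero (⊞-zero (genUp-vanish t (suc t) r t<t+1) (shift-zero (t + suc t) (genDown-vanish t (suc t) r t<t+1)))
          (when-false (shift (suc t) (genDown t (suc t) (r ∸ 1))) (≢⇒≡ᵇ-false (NP.<⇒≢ t<t+1))))
  where
  t<t+1 = NP.n<1+n t

-- The main induction: for t ≤ s, U(s+1,t,r) and F(s+1,t,r) equal their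
-- closed forms, and hence so does D(s+1,t+1,r) = F(s+1,t,r).
mutual
  genUp-closed : ∀ s t r → t ≤ s → genUp (suc s) t r ≐ closedU (suc s) t r
  genUp-closed zero zero r _ = begin
      genUp 1 0 r                                                       ≈⟨ genUp-recurrence 0 0 r ⟩
      genUp 0 0 r ⊞ shift 0 (genDown 0 0 r) ⊞ shift 0 (genDown 0 0 (r ∸ 1)) ≈⟨ ⊞-cong (⊞-cong (genUp-origin r) (genDown-t0 0 r)) (genDown-t0 0 (r ∸ 1)) ⟩
      noMarks r ⊞ 𝟘 ⊞ 𝟘                                                 ≈⟨ ≐-trans (⊞-identityʳ _) (⊞-identityʳ (noMarks r)) ⟩
      noMarks r                                                         ≈⟨ closedU-t0 0 r ⟨
      closedU 1 0 r                                                     ∎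
    where open SeriesReasoning
  genUp-closed (suc s) zero r _ = begin
      genUp (suc (suc s)) 0 r                        ≈⟨ genUp-recurrence (suc s) 0 r ⟩
      genUp (suc s) 0 r ⊞ shift (suc s + 0) (genDown (suc s) 0 r) ⊞ when false (shift 0 (genDown (suc s) 0 (r ∸ 1)))
        ≈⟨ ⊞-identityʳ _ ⟩
      genUp (suc s) 0 r ⊞ shift (suc s + 0) (genDown (suc s) 0 r)
        ≈⟨ ⊞-cong (≐-trans (genUp-closed s 0 r z≤n) (closedU-t0 s r)) (shift-zero (suc s + 0) (genDown-t0 (suc s) r)) ⟩
      noMarks r ⊞ 𝟘                                  ≈⟨ ⊞-identityʳ (noMarks r) ⟩
      noMarks r                                      ≈⟨ closedU-t0 (suc s) r ⟨
      closedU (suc (suc s)) 0 r                      ∎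
    where open SeriesReasoning
  genUp-closed (suc s) (suc t) r (s≤s t≤s) with NP.m≤n⇒m<n∨m≡n t≤s
  ... | inj₂ refl = begin
      genUp (suc (suc t)) (suc t) r                  ≈⟨ genUp-recurrence (suc t) (suc t) r ⟩
      genUp (suc t) (suc t) r ⊞ shift (suc t + suc t) (genDown (suc t) (suc t) r)
        ⊞ when (suc t ≡ᵇ suc t) (shift (suc t) (genDown (suc t) (suc t) (r ∸ 1)))
        ≈⟨ ⊞-cong (⊞-cong (genUp-dyck t r) (shift-cong (suc t + suc t) (genDown-closed t t r NP.≤-refl)))
                  (when-true (shift (suc t) (genDown (suc t) (suc t) (r ∸ 1))) (T⇒≡true (NP.≡⇒≡ᵇ t t refl))) ⟩
      𝟘 ⊞ shift (suc t + suc t) (closedF (suc t) t r) ⊞ shift (suc t) (genDown (suc t) (suc t) (r ∸ 1))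
        ≈⟨ ⊞-cong (⊞-identityˡ (shift (suc t + suc t) (closedF (suc t) t r))) (shift-cong (suc t) (genDown-closed t t (r ∸ 1) NP.≤-refl)) ⟩
      shift (suc t + suc t) (closedF (suc t) t r) ⊞ shift (suc t) (closedF (suc t) t (r ∸ 1))
        ≈⟨ closedU-diag t r ⟨
      closedU (suc (suc t)) (suc t) r                ∎
    where open SeriesReasoning
  ... | inj₁ t<s = begin
      genUp (suc (suc s)) (suc t) r                  ≈⟨ genUp-recurrence (suc s) (suc t) r ⟩
      genUp (suc s) (suc t) r ⊞ shift (suc s + suc t) (genDown (suc s) (suc t) r)
        ⊞ when (suc s ≡ᵇ suc t) (shift (suc t) (genDown (suc s) (suc t) (r ∸ 1)))
        ≈⟨ ⊞-cong (⊞-cong (genUp-closed s (suc t) r t<s) (shift-cong (suc s + suc t) (genDown-closed s t r t≤s)))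
                  (when-false (shift (suc t) (genDown (suc s) (suc t) (r ∸ 1))) (≢⇒≡ᵇ-false (NP.>⇒≢ (s≤s t<s)))) ⟩
      closedU (suc s) (suc t) r ⊞ shift (suc s + suc t) (closedF (suc s) t r) ⊞ 𝟘
        ≈⟨ ⊞-identityʳ _ ⟩
      closedU (suc s) (suc t) r ⊞ shift (suc s + suc t) (closedF (suc s) t r)
        ≈⟨ closedU-step s t r ⟨
      closedU (suc (suc s)) (suc t) r                ∎
    where open SeriesReasoning

  genDown-closed : ∀ s t r → t ≤ s → genDown (suc s) (suc t) r ≐ closedF (suc s) t r
  genDown-closed s t r t≤s = ≐-trans (genDown-recurrence (suc s) t r)
    (≐-trans (when-true (gen (suc s) t r) (<⇒<ᵇ-true (s≤s t≤s))) (gen-closed s t r t≤s))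

  gen-closed : ∀ s t r → t ≤ s → gen (suc s) t r ≐ closedF (suc s) t r
  gen-closed s zero r t≤s = begin
      gen (suc s) 0 r                                ≈⟨ gen-split (suc s) 0 r ⟩
      genUp (suc s) 0 r ⊞ genDown (suc s) 0 r        ≈⟨ ⊞-cong (≐-trans (genUp-closed s 0 r t≤s) (closedU-t0 s r)) (genDown-t0 (suc s) r) ⟩
      noMarks r ⊞ 𝟘                                  ≈⟨ ⊞-identityʳ (noMarks r) ⟩
      noMarks r                                      ≈⟨ closedF-t0 (suc s) r ⟨
      closedF (suc s) 0 r                            ∎
    where open SeriesReasoning
  gen-closed s (suc t) r t<s = begin
      gen (suc s) (suc t) r                          ≈⟨ gen-split (suc s) (suc t) r ⟩
      genUp (suc s) (suc t) r ⊞ genDown (suc s) (suc t) r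
        ≈⟨ ⊞-cong (genUp-closed s (suc t) r t<s) (genDown-closed s t r (NP.<⇒≤ t<s)) ⟩
      closedU (suc s) (suc t) r ⊞ closedF (suc s) t r ≈⟨ closedF-split s t r ⟨
      closedF (suc s) (suc t) r                      ∎
    where open SeriesReasoning

genFun-coeff : ∀ s t r → coeff (genFun s t r) ≐ gen s t r
genFun-coeff s t r = begin
    coeff (genFun s t r)                                     ≈⟨ foldr-coeff (𝒟 s t r) ⟩
    ∑ weight (𝒟 s t r)                                       ≈⟨ ∑-concatMap weight markedCopies (filterᵇ (ballotᵇ s t) (allLists N)) ⟩
    ∑ (λ p → ∑ weight (markedCopies p)) (filterᵇ (ballotᵇ s t) (allLists N))
      ≈⟨ ∑-filter (λ p → ∑ weight (markedCopies p)) (ballotᵇ s t) (allLists N) ⟩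
    ∑ (λ p → when (ballotᵇ s t p) (∑ weight (markedCopies p))) (allLists N)
      ≈⟨ ∑-cong (allLists N) (λ p → when-cong (ballotᵇ s t p) (markings p)) ⟩
    gen s t r                                                ∎
  where
  open SeriesReasoning
  N = s + t
  weight : MarkedPath → Series
  weight D = mono (vmr D)
  markedCopies : Path → List MarkedPath
  markedCopies p = map (λ m → p , m) (filterᵇ (validMarkingᵇ r p) (allLists (suc N)))
  markings : ∀ p → ∑ weight (markedCopies p) ≐ marks N p r
  markings p = ≐-trans (∑-map weight (λ m → p , m) (filterᵇ (validMarkingᵇ r p) (allLists (suc N))))
                       (∑-filter (λ m → mono (vmr (p , m))) (validMarkingᵇ r p) (allLists (suc N)))
  foldr-coeff : ∀ Ds → coeff (foldr (λ D acc → qpow (vmr D) ⊕ acc) [] Ds) ≐ ∑ weight Ds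
  foldr-coeff []       = ≐-refl
  foldr-coeff (D ∷ Ds) = mk≐ λ k → trans (coeff-⊕ (qpow (vmr D)) (foldr (λ D acc → qpow (vmr D) ⊕ acc) [] Ds) k)
                                         (cong (mono (vmr D) k +ℤ_) (app (foldr-coeff Ds) k))

lemma2p1 : (s t r : ℕ) → t < s →
    Σ Poly (λ Q → IsQBinom (s + t) (s + r) Q × genFun s t r ≈ₚ qpow ((r + 1) C 2) ⊗ Q)
lemma2p1 (suc s) t r (s≤s t≤s) = gauss (suc s + t) (suc s + r) , gauss-isQBinom (suc s + t) (suc s + r) , app (begin
    coeff (genFun (suc s) t r)                       ≈⟨ genFun-coeff (suc s) t r ⟩
    gen (suc s) t r                                  ≈⟨ gen-closed s t r t≤s ⟩
    shift (tri r) (Gauss (suc s + t) (suc s + r))    ≈⟨ coeff-qpow-⊗ (tri r) (gauss (suc s + t) (suc s + r)) ⟨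
    coeff (qpow (tri r) ⊗ gauss (suc s + t) (suc s + r)) ∎)
  where open SeriesReasoning
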